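{- Let $T$ be a rooted ordered labeled tree with $n_T$ nodes and let $\mathcal T$ be its top tree produced by the greedy construction. For any internal node $z$ of $T$, the subtree $T(z)$ can be represented by a set of $O(\log n_T)$ clusters of $\mathcal T$, i.e., there are clusters $C_1,\dots,C_\ell$ of $\mathcal T$ with $\ell=O(\log n_T)$ such that $T(z)=C_1\cup\dots\cup C_\ell$ (the union taking node sets and edge sets).
   Context: A labeled tree $T$ is a rooted, ordered tree each of whose nodes carries a label; $n_T$ is its number of nodes and $p(v)$ denotes the parent of $v$. Clusters. For a node $v$ with children $v_1,\dots,v_k$ (left to right), $T(v)$ is the subtree consisting of $v$ and its descendants, $F(v)$ the forest of proper descendants of $v$, and for $1\le s\le r\le k$, $T(v,v_s,v_r)$ is the tree pattern induced by $\{v\}\cup T(v_s)\cup\dots\cup T(v_r)$. A cluster with top boundary node $v$ is either a pattern $T(v,v_s,v_r)$ (no bottom boundary node) or a pattern $T(v,v_s,v_r)\setminus F(u)$ for a node $u$ of $T(v_s)\cup\dots\cup T(v_r)$ ($u$ is its bottom boundary node). A single edge $(v,p(v))$ is a cluster with top boundary $p(v)$, and with bottom boundary $v$ unless $v$ is a leaf of $T$. Two edge-disjoint clusters $A,B$ sharing one boundary node can be merged into $C=A\cup B$ (when $C$ is a cluster) in five ways: vertical merges, where the bottom boundary node of $A$ is the top boundary node of $B$ and $B$ contains all children of this node (allowed only if this node is a boundary node of no cluster other than $A,B$): type (a) if $B$ has a bottom boundary node, type (b) if not; horizontal merges, where $A,B$ have the same top boundary node, $A$ left of $B$, and at least one of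 them has no bottom boundary node: type (c) if only $A$ has a bottom boundary node, (d) if only $B$ has one, (e) if neither has one. $A$ is always the cluster first visited in a preorder traversal of $T$. Top tree. A top tree of $T$ is an ordered rooted binary labeled tree whose nodes correspond to clusters: the root to $T$, the leaves to the edges of $T$ (labeled by the pair (label of parent endpoint, label of child endpoint)), and each internal node to the merge of its left child's cluster $A$ and right child's cluster $B$, labeled by the merge type (a)–(e). Greedy construction. Maintain an auxiliary rooted ordered tree $\tilde T$, initially $T$, whose edges correspond to the current roots of the partial top tree (initially the edges of $T$). Merging edges $(u,v),(v,w)$ of $\tilde T$ creates a new top tree node whose children are the two corresponding clusters; if $v$ is the parent of $u$ and the only child of $w$ (vertical merge) the two edges are replaced by $(u,w)$; if $v$ is the parent of both $u,w$ and one of $u,w$ is a leaf (horizontal merge) they are replaced by a single edge from $v$ to one of $u,w$ (the non-leaf one, if any). While $\tilde T$ has more than one edge, do an iteration: Step 1 (horizontal): for each node $v$ of $\tilde T$ with children $v_1,\dots,v_k$, $k\ge 2$, for $i=1,\dots,\lfloor k/2\rfloor$ merge $(v,v_{2i-1}),(v,v_{2i})$ if $v_{2i-1}$ or $v_{2i}$ is a leaf; if $k$ is odd, $v_k$ is a leaf and $v_{k-2},v_{k-1}$ are non-leaves, also merge $(v,v_{k-1}),(v,v_k)$. Step 2 (vertical): for each maximal path $v_1,\dots,v_p$ with $v_{i+1}$ the parent of $v_i$ and $v_2,\dots,v_{p-1}$ each having exactly one child, with $e_i=(v_i,v_{i+1})$: if $p$ is even merge $\{e_1,e_2\},\{e_3,e_4\},\dots,\{e_{p-3},e_{p-2}\}$;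 if $p$ is odd merge $\{e_1,e_2\},\dots,\{e_{p-4},e_{p-3}\}$ and also $\{e_{p-2},e_{p-1}\}$ if $e_{p-1}$ was not merged in Step 1. -}

module Defs where

open import Data.Nat using (ℕ; zero; suc; _+_)
open import Data.Bool using (Bool; true; false; if_then_else_; not; _∨_; _∧_)
open import Data.List using (List; []; _∷_; _++_; [_])
open import Data.Maybe using (Maybe; just; nothing)
open import Data.Product using (_×_; _,_; Σ; ∃)
open import Data.Sum using (_⊎_)
open import Data.Empty using (⊥)
open import Data.List.Relation.Unary.Any using (Any)
open import Relation.Binary.PropositionalEquality using (_≡_; _≢_)

-- Rooted ordered labeled trees (rose trees).  Nodes are addressed by
-- paths: [] is the root, and (i ∷ p) is the node at path p inside the
-- i-th child (0-based) of the root.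

data Tree (A : Set) : Set where
  node : A → List (Tree A) → Tree A

Path : Set
Path = List ℕ

_‼_ : {X : Set} → List X → ℕ → Maybe X
[]       ‼ _     = nothing
(x ∷ xs) ‼ zero  = just x
(x ∷ xs) ‼ suc i = xs ‼ i

data Pos {A : Set} : Tree A → Path → Set where
  here  : ∀ {t} → Pos t []
  there : ∀ {a ts i t p} → ts ‼ i ≡ just t → Pos t p → Pos (node a ts) (i ∷ p)

mutual
  size : {A : Set} → Tree A → ℕ
  size (node _ ts) = suc (sizes ts)

  sizes : {A : Set} → List (Tree A) → ℕ
  sizes []       = 0
  sizes (t ∷ ts) = size t + sizes ts

label : {A : Set} → Tree A → A
label (node a _) = a

Internal : {A : Set} → Tree A → Path → Set
Internal T z = ∃ λ i → Pos T (z ++ [ i ])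

NodeOfSubtree : {A : Set} → Tree A → Path → Path → Set
NodeOfSubtree T z q = Pos T q × ∃ λ r → q ≡ z ++ r

-- Edges of T are identified by their child endpoint q ≠ [] (the edge is
-- (q, p(q))).  q is an edge of T(z) iff q is a proper descendant of z.
EdgeOfSubtree : {A : Set} → Tree A → Path → Path → Set
EdgeOfSubtree T z q = Pos T q × ∃ λ r → r ≢ [] × q ≡ z ++ r

-- A leaf is an edge of T, recorded by its identity (the path
-- of its child endpoint) and labeled by (label of parent endpoint, label
-- of child endpoint); internal nodes are labeled by the merge type.

data MergeType : Set where
  a b c d e : MergeType

data TopTree (A : Set) : Set where
  leaf  : Path → A → A → TopTree A
  merge : MergeType → TopTree A → TopTree A → TopTree A
  -- merge τ L R : left child L is cluster A, right child R is cluster B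

data EdgeOf {A : Set} : TopTree A → Path → Set where
  leaf   : ∀ {q x y} → EdgeOf (leaf q x y) q
  left   : ∀ {τ L R q} → EdgeOf L q → EdgeOf (merge τ L R) q
  right  : ∀ {τ L R q} → EdgeOf R q → EdgeOf (merge τ L R) q

NodeOf : {A : Set} → TopTree A → Path → Set
NodeOf C q = ∃ λ q' → EdgeOf C q' × (q ≡ q' ⊎ ∃ λ i → q' ≡ q ++ [ i ])

data ClusterOf {A : Set} : TopTree A → TopTree A → Set where
  root   : ∀ {C} → ClusterOf C C
  inLeft  : ∀ {C τ L R} → ClusterOf C L → ClusterOf C (merge τ L R)
  inRight : ∀ {C τ L R} → ClusterOf C R → ClusterOf C (merge τ L R)

-- The auxiliary tree T̃: an ordered rooted tree each of whose edges
-- carries the root of a partial top tree (the cluster of that edge).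

data Aux (A : Set) : Set where
  anode : List (TopTree A × Aux A) → Aux A

-- same, with a flag on each edge recording whether it was created by a
-- merge in Step 1 of the current iteration
data Aux' (A : Set) : Set where
  anode' : List (TopTree A × Bool × Aux' A) → Aux' A

mutual
  initAux : {A : Set} → Path → Tree A → Aux A
  initAux p (node x ts) = anode (initChildren p x 0 ts)

  initChildren : {A : Set} → Path → A → ℕ → List (Tree A) → List (TopTree A × Aux A)
  initChildren p x i []       = []
  initChildren p x i (t ∷ ts) =
    (leaf (p ++ [ i ]) x (label t) , initAux (p ++ [ i ]) t) ∷ initChildren p x (suc i) ts

isLeaf : {A : Set} → Aux A → Bool
isLeaf (anode []) = true
isLeaf (anode (_ ∷ _)) = false

isLeaf' : {A : Set} → Aux' A → Bool
isLeaf' (anode' []) = true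
isLeaf' (anode' (_ ∷ _)) = false

mutual
  edges : {A : Set} → Aux A → ℕ
  edges (anode cs) = edgesL cs

  edgesL : {A : Set} → List (TopTree A × Aux A) → ℕ
  edgesL [] = 0
  edgesL ((_ , u) ∷ cs) = suc (edges u + edgesL cs)

-- Merging the edges (v,u₁),(v,u₂) (u₁ left
-- of u₂, at least one a leaf): A = cluster of (v,u₁), B = cluster of
-- (v,u₂); a cluster of an edge (v,u) of T̃ has a bottom boundary node iff
-- u is not a leaf of T̃.  The new edge goes to the non-leaf one (if any).

mutual
  step1 : {A : Set} → Aux A → Aux' A
  step1 (anode cs) = anode' (pairUp cs)

  keep : {A : Set} → TopTree A × Aux A → TopTree A × Bool × Aux' A
  keep (C , u) = (C , false , step1 u)

  hmerge : {A : Set} → TopTree A × Aux A → TopTree A × Aux A → TopTree A × Bool × Aux' A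
  hmerge (C₁ , u₁) (C₂ , u₂) with isLeaf u₁ | isLeaf u₂
  ... | false | _    = (merge c C₁ C₂ , true , step1 u₁)
  ... | true  | false = (merge d C₁ C₂ , true , step1 u₂)
  ... | true  | true  = (merge e C₁ C₂ , true , step1 u₁)

  pairUp : {A : Set} → List (TopTree A × Aux A) → List (TopTree A × Bool × Aux' A)
  pairUp [] = []
  pairUp (x ∷ []) = keep x ∷ []
  pairUp (x ∷ y ∷ []) =
    if isLeaf (Data.Product.proj₂ x) ∨ isLeaf (Data.Product.proj₂ y)
    then hmerge x y ∷ []
    else keep x ∷ keep y ∷ []
  pairUp (x ∷ y ∷ z ∷ []) =
    if isLeaf (Data.Product.proj₂ x) ∨ isLeaf (Data.Product.proj₂ y)
    then hmerge x y ∷ keep z ∷ []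
    else (if isLeaf (Data.Product.proj₂ z)
          -- k odd, v_k a leaf, v_{k-2}, v_{k-1} non-leaves
          then keep x ∷ hmerge y z ∷ []
          else keep x ∷ keep y ∷ keep z ∷ [])
  pairUp (x ∷ y ∷ w ∷ z ∷ rest) =
    if isLeaf (Data.Product.proj₂ x) ∨ isLeaf (Data.Product.proj₂ y)
    then hmerge x y ∷ pairUp (w ∷ z ∷ rest)
    else keep x ∷ keep y ∷ pairUp (w ∷ z ∷ rest)

-- For a node u, down u is the number of edges
-- of the maximal path below u (u, its only child, its only child, ...),
-- so an edge (u, p(u)) is the edge e_i with i = down u + 1 of its
-- maximal path.  The edge e_i is merged with e_{i-1} iff i is even and,
-- in case e_i is the topmost edge e_{p-1} of its path, it was not merged
-- in Step 1.  The path containing the child edges of v has v as topmost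
-- node iff v is the root or v has at least two children.  In a merge of
-- e_{i}=(u,v) and e_{i-1}=(w,u), A = cluster of e_i (the upper one),
-- B = cluster of e_{i-1}; type (a) if w is not a leaf, (b) otherwise.

isEven : ℕ → Bool
isEven zero = true
isEven (suc zero) = false
isEven (suc (suc n)) = isEven n

down : {A : Set} → Aux' A → ℕ
down (anode' ((_ , _ , w) ∷ [])) = suc (down w)
down _ = 0

atLeastTwo : {X : Set} → List X → Bool
atLeastTwo (_ ∷ _ ∷ _) = true
atLeastTwo _ = false

mutual
  step2 : {A : Set} → Bool → Aux' A → Aux A
  step2 isRoot (anode' cs) = anode (step2L (isRoot ∨ atLeastTwo cs) cs)

  step2L : {A : Set} → Bool → List (TopTree A × Bool × Aux' A) → List (TopTree A × Aux A)
  step2L top [] = []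
  step2L top ((C , f , u) ∷ xs) = step2E top C f u ∷ step2L top xs

  step2E : {A : Set} → Bool → TopTree A → Bool → Aux' A → TopTree A × Aux A
  step2E top C f (anode' ((C' , f' , w) ∷ [])) =
    if isEven (down w) ∧ (not top ∨ not f)
    then (merge (if isLeaf' w then b else a) C C' , step2 false w)
    else (C , anode (step2E false C' f' w ∷ []))
  step2E top C f (anode' []) = (C , anode [])
  step2E top C f (anode' (y₁ ∷ y₂ ∷ ys)) =
    (C , anode (step2L true (y₁ ∷ y₂ ∷ ys)))

iteration : {A : Set} → Aux A → Aux A
iteration t = step2 true (step1 t)

data Greedy {A : Set} : Aux A → TopTree A → Set where
  done : ∀ {C u} → edges u ≡ 0 → Greedy (anode ((C , u) ∷ [])) C
  loop : ∀ {t 𝒯} → (edges t ≡ 0 → ⊥) → (edges t ≡ 1 → ⊥) → Greedy (iteration t) 𝒯 → Greedy t 𝒯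

GreedyTopTree : {A : Set} → Tree A → TopTree A → Set
GreedyTopTree T 𝒯 = Greedy (initAux [] T) 𝒯

-- Every cluster built by the greedy construction is connected below its top boundary node v: with each
-- of its edges it contains the whole path from v down to that edge. So a cluster with edges both inside
-- and outside T(z) contains the edge above z; as every edge of T is exactly one leaf of the top tree,
-- the maximal clusters inside T(z) are reached by descending along a single path of the top tree, and
-- there are at most its height plus one of them.
-- Each iteration adds at most two levels to the top tree and shrinks T̃ by a factor 12/13: if Step 1
-- performs F horizontal merges and leaves B leaves below nodes with at least two children, then B ≤ 2F
-- and Step 2 leaves at most (3/4)(n − F) + B + F of the n edges. Hence there are O(log n_T) iterations.

module Submission where

open import Defs hiding (a; b; c; d; e)
open import Data.Bool using (Bool; true; false; if_then_else_; not; _∨_; _∧_)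
open import Data.Empty using (⊥; ⊥-elim)
open import Data.List using (List; []; _∷_; _++_; [_]; length; map)
open import Data.List.Properties using (++-assoc; ++-identityʳ; length-++; ∷-injective; ++-cancelˡ; ≡-dec)
open import Data.List.Relation.Unary.All as All using (All; []; _∷_; lookupAny)
open import Data.List.Relation.Unary.All.Properties using (++⁺)
open import Data.List.Relation.Unary.Any as Any using (Any; here; there)
open import Data.List.Relation.Unary.Any.Properties using (++⁺ˡ; ++⁺ʳ)
open import Data.Maybe using (just)
open import Data.Nat using (ℕ; zero; suc; _+_; _*_; _^_; _≤_; _<_; _⊔_; _/_; _%_; _≟_; z≤n; s≤s; s≤s⁻¹)
open import Data.Nat.DivMod using (m≡m%n+[m/n]*n; m%n<n)
open import Data.Nat.ListAction using (sum)
open import Data.Nat.Logarithm using (⌊log₂_⌋; ⌊log₂⌋-mono-≤; ⌊log₂[2^n]⌋≡n)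
open import Data.Nat.Properties
open import Data.Nat.Tactic.RingSolver using (solve-∀)
open import Data.Product using (_×_; _,_; proj₁; proj₂; ∃; ∃₂)
open import Data.Sum using (_⊎_; inj₁; inj₂)
open import Function.Bundles using (_⇔_; mk⇔)
open import Relation.Nullary using (¬_; Dec; yes; no)
open import Relation.Binary.PropositionalEquality hiding ([_])

-- Paths

infix 4 _⊑_ _⊏_ _⊏?_

_⊑_ : Path → Path → Set
p ⊑ q = ∃ λ r → q ≡ p ++ r

_⊏_ : Path → Path → Set
p ⊏ q = ∃ λ r → r ≢ [] × q ≡ p ++ r

++-prefixes : ∀ (p r p′ r′ : Path) → p ++ r ≡ p′ ++ r′ → p ⊑ p′ ⊎ p′ ⊑ p
++-prefixes []      r p′       r′ eq = inj₁ (p′ , refl)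
++-prefixes (x ∷ p) r []       r′ eq = inj₂ (x ∷ p , refl)
++-prefixes (x ∷ p) r (y ∷ p′) r′ eq with ∷-injective eq
... | refl , eq′ with ++-prefixes p r p′ r′ eq′
...   | inj₁ (s , e) = inj₁ (s , cong (x ∷_) e)
...   | inj₂ (s , e) = inj₂ (s , cong (x ∷_) e)

⊑⇒≡⊎⊏ : ∀ {p q} → p ⊑ q → p ≡ q ⊎ p ⊏ q
⊑⇒≡⊎⊏ {p} ([]    , e) = inj₁ (sym (trans e (++-identityʳ p)))
⊑⇒≡⊎⊏     (x ∷ r , e) = inj₂ (x ∷ r , (λ ()) , e)

⊏⇒⊑ : ∀ {p q} → p ⊏ q → p ⊑ q
⊏⇒⊑ (r , _ , e) = r , e

⊏-length : ∀ {p q} → p ⊏ q → length p < length q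
⊏-length {p} ([]    , r≢[] , _)   = ⊥-elim (r≢[] refl)
⊏-length {p} (x ∷ r , _    , refl) =
  subst (length p <_) (sym (length-++ p)) (m<m+n (length p) (s≤s z≤n))

⊏-irrefl : ∀ {p} → ¬ p ⊏ p
⊏-irrefl p⊏p = <-irrefl refl (⊏-length p⊏p)

⊏-trans : ∀ {p q s} → p ⊏ q → q ⊏ s → p ⊏ s
⊏-trans {p} ([]    , r≢[] , _)    _               = ⊥-elim (r≢[] refl)
⊏-trans {p} (x ∷ r , _    , refl) (r′ , _ , refl) = x ∷ r ++ r′ , (λ ()) , ++-assoc p (x ∷ r) r′

⊏-snoc : ∀ p i → p ⊏ p ++ [ i ]
⊏-snoc p i = [ i ] , (λ ()) , refl

⊏-snoc-tight : ∀ {p q} i → p ⊏ q → ¬ q ⊏ p ++ [ i ]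
⊏-snoc-tight {p} {q} i p⊏q q⊏p∷i =
  <⇒≱ (⊏-length p⊏q)
    (s≤s⁻¹ (subst (length q <_) (trans (length-++ p) (+-comm (length p) 1)) (⊏-length q⊏p∷i)))

⊏-compare : ∀ {p p′ q} → p ⊏ q → p′ ⊏ q → p ≡ p′ ⊎ p ⊏ p′ ⊎ p′ ⊏ p
⊏-compare (r , _ , e) (r′ , _ , e′) with ++-prefixes _ r _ r′ (trans (sym e) e′)
... | inj₁ p⊑p′ with ⊑⇒≡⊎⊏ p⊑p′
...   | inj₁ p≡p′ = inj₁ p≡p′
...   | inj₂ p⊏p′ = inj₂ (inj₁ p⊏p′)
⊏-compare _ _ | inj₂ p′⊑p with ⊑⇒≡⊎⊏ p′⊑p
...   | inj₁ p′≡p = inj₁ (sym p′≡p)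
...   | inj₂ p′⊏p = inj₂ (inj₂ p′⊏p)

_⊏?_ : ∀ p q → Dec (p ⊏ q)
[]      ⊏? []      = no λ { ([] , r≢[] , _) → r≢[] refl ; (_ ∷ _ , _ , ()) }
[]      ⊏? (y ∷ q) = yes (y ∷ q , (λ ()) , refl)
(x ∷ p) ⊏? []      = no λ { (_ , _ , ()) }
(x ∷ p) ⊏? (y ∷ q) with x ≟ y | p ⊏? q
... | yes refl | yes (r , r≢[] , e) = yes (r , r≢[] , cong (x ∷_) e)
... | yes refl | no ¬p⊏q = no λ { (r , r≢[] , e) → ¬p⊏q (r , r≢[] , proj₂ (∷-injective e)) }
... | no x≢y   | _ = no λ { (_ , _ , e) → x≢y (sym (proj₁ (∷-injective e))) }

⊏-parent : ∀ {z q} i → z ⊏ q ++ [ i ] → z ⊑ q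
⊏-parent {z} {q} i z⊏q∷i@(r , _ , eq) with ++-prefixes z r q [ i ] (sym eq)
... | inj₁ z⊑q = z⊑q
... | inj₂ q⊑z with ⊑⇒≡⊎⊏ q⊑z
...   | inj₁ refl = [] , sym (++-identityʳ q)
...   | inj₂ q⊏z  = ⊥-elim (⊏-snoc-tight i q⊏z z⊏q∷i)

Pos-prefix : ∀ {A : Set} (T : Tree A) q {s} → Pos T (q ++ s) → Pos T q
Pos-prefix T           []      _              = here
Pos-prefix (node _ ts) (i ∷ q) (there lk pos) = there lk (Pos-prefix _ q pos)

++-nonempty : ∀ z {r : Path} → r ≢ [] → z ++ r ≢ []
++-nonempty []      r≢[] = r≢[]
++-nonempty (_ ∷ _) _    ()

-- Clusters

module _ {A : Set} where

  -- v is the top boundary node of the cluster C.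
  ConnectedBelow : Path → TopTree A → Set
  ConnectedBelow v C = ∀ {q} → EdgeOf C q → v ⊏ q × (∀ {q′} → v ⊏ q′ → q′ ⊏ q → EdgeOf C q′)

  connected-leaf : ∀ p i {x y : A} → ConnectedBelow p (leaf (p ++ [ i ]) x y)
  connected-leaf p i leaf = ⊏-snoc p i , λ p⊏q′ q′⊏p∷i → ⊥-elim (⊏-snoc-tight i p⊏q′ q′⊏p∷i)

  connected-horizontal : ∀ {v τ L R} → ConnectedBelow v L → ConnectedBelow v R → ConnectedBelow v (merge τ L R)
  connected-horizontal cL cR (left  e) = proj₁ (cL e) , λ h₁ h₂ → left  (proj₂ (cL e) h₁ h₂)
  connected-horizontal cL cR (right e) = proj₁ (cR e) , λ h₁ h₂ → right (proj₂ (cR e) h₁ h₂)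

  connected-vertical : ∀ {v w τ L R} → EdgeOf L w → ConnectedBelow v L → ConnectedBelow w R →
                       ConnectedBelow v (merge τ L R)
  connected-vertical ew cL cR (left e) = proj₁ (cL e) , λ h₁ h₂ → left (proj₂ (cL e) h₁ h₂)
  connected-vertical {v} {w} {τ} {L} {R} ew cL cR {q} (right e) = ⊏-trans v⊏w w⊏q , via-w
    where
    v⊏w : v ⊏ w
    v⊏w = proj₁ (cL ew)
    w⊏q : w ⊏ q
    w⊏q = proj₁ (cR e)
    via-w : ∀ {q′} → v ⊏ q′ → q′ ⊏ q → EdgeOf (merge τ L R) q′
    via-w v⊏q′ q′⊏q with ⊏-compare q′⊏q w⊏q
    ... | inj₁ refl        = left ew
    ... | inj₂ (inj₁ q′⊏w) = left (proj₂ (cL ew) v⊏q′ q′⊏w)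
    ... | inj₂ (inj₂ w⊏q′) = right (proj₂ (cR e) w⊏q′ q′⊏q)

  data Clustered : TopTree A → Set where
    leaf  : ∀ {q x y} → Clustered (leaf q x y)
    merge : ∀ {τ L R} v → ConnectedBelow v (merge τ L R) → Clustered L → Clustered R → Clustered (merge τ L R)

  height : TopTree A → ℕ
  height (leaf _ _ _)  = 0
  height (merge _ L R) = suc (height L ⊔ height R)

  record Spanning (H : ℕ) (v w : Path) (C : TopTree A) : Set where
    constructor spanning
    field
      bottom    : EdgeOf C w
      connected : ConnectedBelow v C
      clustered : Clustered C
      shallow   : height C ≤ H

  spanning-leaf : ∀ p i {x y : A} → Spanning 0 p (p ++ [ i ]) (leaf (p ++ [ i ]) x y)
  spanning-leaf p i = spanning leaf (connected-leaf p i) leaf z≤n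

  spanning-weaken : ∀ {H v w C} → Spanning H v w C → Spanning (suc H) v w C
  spanning-weaken (spanning b c k h) = spanning b c k (m≤n⇒m≤1+n h)

  spanning-horizontal : ∀ {H v w₁ w₂ C₁ C₂} τ → Spanning H v w₁ C₁ → Spanning H v w₂ C₂ →
                        Spanning (suc H) v w₁ (merge τ C₁ C₂) × Spanning (suc H) v w₂ (merge τ C₁ C₂)
  spanning-horizontal {v = v} τ (spanning b₁ c₁ k₁ h₁) (spanning b₂ c₂ k₂ h₂) =
    spanning (left b₁) c k h , spanning (right b₂) c k h
    where
    c = connected-horizontal c₁ c₂
    k = merge v c k₁ k₂
    h = s≤s (⊔-lub h₁ h₂)

  spanning-vertical : ∀ {H v w w′ C C′} τ → Spanning H v w C → Spanning H w w′ C′ →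
                      Spanning (suc H) v w′ (merge τ C C′)
  spanning-vertical {v = v} τ (spanning b₁ c₁ k₁ h₁) (spanning b₂ c₂ k₂ h₂) =
    spanning (right b₂) c (merge v c k₁ k₂) (s≤s (⊔-lub h₁ h₂))
    where
    c = connected-vertical b₁ c₁ c₂

  occ : Path → TopTree A → ℕ
  occ q (leaf p _ _) with ≡-dec _≟_ q p
  ... | yes _ = 1
  ... | no  _ = 0
  occ q (merge _ L R) = occ q L + occ q R

  occ-leaf-≡ : ∀ q {x y : A} → occ q (leaf q x y) ≡ 1
  occ-leaf-≡ q with ≡-dec _≟_ q q
  ... | yes _   = refl
  ... | no  q≢q = ⊥-elim (q≢q refl)

  EdgeOf⇒occ>0 : ∀ {C q} → EdgeOf C q → 0 < occ q C
  EdgeOf⇒occ>0 {leaf q x y} leaf = ≤-reflexive (sym (occ-leaf-≡ q {x} {y}))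
  EdgeOf⇒occ>0 {merge _ L R} (left e)  = ≤-trans (EdgeOf⇒occ>0 e) (m≤m+n _ _)
  EdgeOf⇒occ>0 {merge _ L R} (right e) = ≤-trans (EdgeOf⇒occ>0 e) (m≤n+m _ _)

  occ>0⇒EdgeOf : ∀ C {q} → 0 < occ q C → EdgeOf C q
  occ>0⇒EdgeOf (leaf p x y) {q} occ>0 with ≡-dec _≟_ q p
  ... | yes refl = leaf
  occ>0⇒EdgeOf (merge τ L R) {q} occ>0 with occ q L in eq
  ... | zero  = right (occ>0⇒EdgeOf R occ>0)
  ... | suc _ = left (occ>0⇒EdgeOf L (subst (0 <_) (sym eq) (s≤s z≤n)))

  ClusterOf-edge : ∀ {C 𝒯 : TopTree A} {q} → ClusterOf C 𝒯 → EdgeOf C q → EdgeOf 𝒯 q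
  ClusterOf-edge root        e = e
  ClusterOf-edge (inLeft c)  e = left  (ClusterOf-edge c e)
  ClusterOf-edge (inRight c) e = right (ClusterOf-edge c e)

module _ {A : Set} where

  Inside : Path → TopTree A → Set
  Inside z C = ∀ {q} → EdgeOf C q → z ⊏ q

  Escapes : Path → TopTree A → Set
  Escapes z C = ∃ λ q → EdgeOf C q × ¬ z ⊏ q

  Meets : Path → TopTree A → Set
  Meets z C = ∃ λ q → EdgeOf C q × z ⊏ q

  Avoids : Path → TopTree A → Set
  Avoids z C = ∀ {q} → EdgeOf C q → ¬ z ⊏ q

  inside-or-escapes : ∀ z C → Inside z C ⊎ Escapes z C
  inside-or-escapes z (leaf q x y) with z ⊏? q
  ... | yes z⊏q = inj₁ λ { leaf → z⊏q }
  ... | no ¬z⊏q = inj₂ (q , leaf , ¬z⊏q)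
  inside-or-escapes z (merge τ L R) with inside-or-escapes z L | inside-or-escapes z R
  ... | inj₁ inL | inj₁ inR = inj₁ λ { (left e) → inL e ; (right e) → inR e }
  ... | inj₂ (q , e , ¬z⊏q) | _ = inj₂ (q , left e , ¬z⊏q)
  ... | inj₁ _ | inj₂ (q , e , ¬z⊏q) = inj₂ (q , right e , ¬z⊏q)

  meets-or-avoids : ∀ z C → Meets z C ⊎ Avoids z C
  meets-or-avoids z (leaf q x y) with z ⊏? q
  ... | yes z⊏q = inj₁ (q , leaf , z⊏q)
  ... | no ¬z⊏q = inj₂ λ { leaf → ¬z⊏q }
  meets-or-avoids z (merge τ L R) with meets-or-avoids z L | meets-or-avoids z R
  ... | inj₁ (q , e , z⊏q) | _ = inj₁ (q , left e , z⊏q)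
  ... | inj₂ _ | inj₁ (q , e , z⊏q) = inj₁ (q , right e , z⊏q)
  ... | inj₂ avL | inj₂ avR = inj₂ λ { (left e) → avL e ; (right e) → avR e }

  pieces : Path → TopTree A → List (TopTree A)
  pieces z C with inside-or-escapes z C | meets-or-avoids z C
  pieces z C             | inj₁ _ | _      = C ∷ []
  pieces z C             | inj₂ _ | inj₂ _ = []
  pieces z (leaf _ _ _)  | inj₂ _ | inj₁ _ = []
  pieces z (merge _ L R) | inj₂ _ | inj₁ _ = pieces z L ++ pieces z R

  pieces-clusters : ∀ z C → All (λ P → ClusterOf P C) (pieces z C)
  pieces-clusters z C with inside-or-escapes z C | meets-or-avoids z C
  pieces-clusters z C             | inj₁ _ | _      = root ∷ []
  pieces-clusters z C             | inj₂ _ | inj₂ _ = []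
  pieces-clusters z (leaf _ _ _)  | inj₂ _ | inj₁ _ = []
  pieces-clusters z (merge _ L R) | inj₂ _ | inj₁ _ =
    ++⁺ (All.map inLeft (pieces-clusters z L)) (All.map inRight (pieces-clusters z R))

  pieces-inside : ∀ z C → All (Inside z) (pieces z C)
  pieces-inside z C with inside-or-escapes z C | meets-or-avoids z C
  pieces-inside z C             | inj₁ inC | _      = inC ∷ []
  pieces-inside z C             | inj₂ _   | inj₂ _ = []
  pieces-inside z (leaf _ _ _)  | inj₂ _   | inj₁ _ = []
  pieces-inside z (merge _ L R) | inj₂ _   | inj₁ _ = ++⁺ (pieces-inside z L) (pieces-inside z R)

  pieces-complete : ∀ z C {q} → EdgeOf C q → z ⊏ q → Any (λ P → EdgeOf P q) (pieces z C)
  pieces-complete z C e z⊏q with inside-or-escapes z C | meets-or-avoids z C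
  pieces-complete z C             e         z⊏q | inj₁ _ | _      = here e
  pieces-complete z C             e         z⊏q | inj₂ _ | inj₂ avC = ⊥-elim (avC e z⊏q)
  pieces-complete z (leaf _ _ _)  leaf      z⊏q | inj₂ (_ , leaf , ¬z⊏q) | inj₁ _ = ⊥-elim (¬z⊏q z⊏q)
  pieces-complete z (merge _ L R) (left e)  z⊏q | inj₂ _ | inj₁ _ = ++⁺ˡ (pieces-complete z L e z⊏q)
  pieces-complete z (merge _ L R) (right e) z⊏q | inj₂ _ | inj₁ _ = ++⁺ʳ (pieces z L) (pieces-complete z R e z⊏q)

  -- The path from the top boundary node v down to an edge inside T(z) passes through the edge above z.
  straddling⇒edge : ∀ {v z C} → ConnectedBelow v C → Escapes z C → Meets z C → EdgeOf C z
  straddling⇒edge {v} cC (q′ , e′ , ¬z⊏q′) (q , e , z⊏q) with ⊏-compare z⊏q (proj₁ (cC e))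
  ... | inj₁ refl        = ⊥-elim (¬z⊏q′ (proj₁ (cC e′)))
  ... | inj₂ (inj₁ z⊏v)  = ⊥-elim (¬z⊏q′ (⊏-trans z⊏v (proj₁ (cC e′))))
  ... | inj₂ (inj₂ v⊏z)  = proj₂ (cC e) v⊏z z⊏q

  pieces-few : ∀ z C → Clustered C → length (pieces z C) ≤ 1 ⊎ EdgeOf C z
  pieces-few z C k with inside-or-escapes z C | meets-or-avoids z C
  pieces-few z C             k               | inj₁ _  | _      = inj₁ ≤-refl
  pieces-few z C             k               | inj₂ _  | inj₂ _ = inj₁ z≤n
  pieces-few z (leaf _ _ _)  k               | inj₂ _  | inj₁ _ = inj₁ z≤n
  pieces-few z (merge _ L R) (merge v cC _ _) | inj₂ es | inj₁ ms = inj₂ (straddling⇒edge cC es ms)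

  pieces-length : ∀ z C → Clustered C → (∀ q → occ q C ≤ 1) → length (pieces z C) ≤ suc (height C)
  pieces-length z C k occ≤1 with inside-or-escapes z C | meets-or-avoids z C
  pieces-length z C             k occ≤1 | inj₁ _ | _      = s≤s z≤n
  pieces-length z C             k occ≤1 | inj₂ _ | inj₂ _ = z≤n
  pieces-length z (leaf _ _ _)  k occ≤1 | inj₂ _ | inj₁ _ = z≤n
  pieces-length z (merge _ L R) (merge _ _ kL kR) occ≤1 | inj₂ _ | inj₁ _
    rewrite length-++ (pieces z L) {pieces z R}
    with pieces-few z L kL | pieces-few z R kR
  ... | inj₂ eL | inj₂ eR =
    ⊥-elim (<-irrefl refl (≤-trans (+-mono-≤ (EdgeOf⇒occ>0 eL) (EdgeOf⇒occ>0 eR)) (occ≤1 z)))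
  ... | inj₁ fewL | _ =
    ≤-trans (+-mono-≤ fewL (pieces-length z R kR (λ q → ≤-trans (m≤n+m _ _) (occ≤1 q))))
            (s≤s (s≤s (m≤n⊔m (height L) (height R))))
  ... | inj₂ _ | inj₁ fewR =
    ≤-trans (+-mono-≤ (pieces-length z L kL (λ q → ≤-trans (m≤m+n _ _) (occ≤1 q))) fewR)
            (≤-trans (≤-reflexive (+-comm (suc (height L)) 1)) (s≤s (s≤s (m≤m⊔n (height L) (height R)))))

-- The auxiliary tree

AuxEdge AuxEdge' : Set → Set
AuxEdge  A = TopTree A × Aux A
AuxEdge' A = TopTree A × Bool × Aux' A

module _ {A : Set} where

  mutual
    occA : Path → Aux A → ℕ
    occA q (anode cs) = occAs q cs

    occAs : Path → List (AuxEdge A) → ℕ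
    occAs q []             = 0
    occAs q ((C , u) ∷ cs) = occ q C + occA q u + occAs q cs

  mutual
    occA' : Path → Aux' A → ℕ
    occA' q (anode' cs) = occAs' q cs

    occAs' : Path → List (AuxEdge' A) → ℕ
    occAs' q []                 = 0
    occAs' q ((C , _ , u) ∷ cs) = occ q C + occA' q u + occAs' q cs

  mutual
    data Spanned (H : ℕ) : Path → Aux A → Set where
      anode : ∀ {v cs} → All (SpannedEdge H v) cs → Spanned H v (anode cs)

    data SpannedEdge (H : ℕ) (v : Path) : AuxEdge A → Set where
      edge : ∀ {C u} w → Spanning H v w C → Spanned H w u → SpannedEdge H v (C , u)

  mutual
    data Spanned' (H : ℕ) : Path → Aux' A → Set where
      anode' : ∀ {v cs} → All (SpannedEdge' H v) cs → Spanned' H v (anode' cs)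

    data SpannedEdge' (H : ℕ) (v : Path) : AuxEdge' A → Set where
      edge : ∀ {C f u} w → Spanning H v w C → Spanned' H w u → SpannedEdge' H v (C , f , u)

  mutual
    Aux-ind : (P : Aux A → Set) → (∀ {cs} → All (λ e → P (proj₂ e)) cs → P (anode cs)) → ∀ t → P t
    Aux-ind P step (anode cs) = step (Aux-ind-children P step cs)

    Aux-ind-children : (P : Aux A → Set) → (∀ {cs} → All (λ e → P (proj₂ e)) cs → P (anode cs)) →
                       ∀ cs → All (λ e → P (proj₂ e)) cs
    Aux-ind-children P step []             = []
    Aux-ind-children P step ((C , u) ∷ cs) = Aux-ind P step u ∷ Aux-ind-children P step cs

¬>0⇒≡0 : ∀ {n} → ¬ 0 < n → n ≡ 0
¬>0⇒≡0 ¬n>0 = n≤0⇒n≡0 (≮⇒≥ ¬n>0)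

positive-+ : ∀ m {n} → 0 < m + n → 0 < m ⊎ 0 < n
positive-+ zero    n>0 = inj₂ n>0
positive-+ (suc m) _   = inj₁ (s≤s z≤n)

module _ {A : Set} where

  mutual
    initAux-below : ∀ p (t : Tree A) {q} → 0 < occA q (initAux p t) → p ⊏ q × ∃ λ r → q ≡ p ++ r × Pos t r
    initAux-below p (node x ts) occ>0 with initChildren-below p x 0 ts occ>0
    ... | j , r , refl , pos = (j ∷ r , (λ ()) , refl) , j ∷ r , refl , pos

    initChildren-below : ∀ p (x : A) i ts {q} → 0 < occAs q (initChildren p x i ts) →
                         ∃₂ λ j r → q ≡ p ++ (i + j) ∷ r × Pos (node x ts) (j ∷ r)
    initChildren-below p x i (t ∷ ts) {q} occ>0 with ≡-dec _≟_ q (p ++ [ i ])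
    ... | yes refl = 0 , [] , cong (λ k → p ++ [ k ]) (sym (+-identityʳ i)) , there refl here
    ... | no _ with positive-+ (occA q (initAux (p ++ [ i ]) t)) occ>0
    ...   | inj₁ occ₁>0 with initAux-below (p ++ [ i ]) t occ₁>0
    ...     | _ , r , refl , pos =
      0 , r , trans (++-assoc p [ i ] r) (cong (λ k → p ++ k ∷ r) (sym (+-identityʳ i))) , there refl pos
    initChildren-below p x i (t ∷ ts) occ>0 | no _ | inj₂ occ₂>0 with initChildren-below p x (suc i) ts occ₂>0
    ... | j , r , refl , there lk pos = suc j , r , cong (λ k → p ++ k ∷ r) (sym (+-suc i j)) , there lk pos

  mutual
    initAux-complete : ∀ p (t : Tree A) {r} → Pos t r → r ≢ [] → 0 < occA (p ++ r) (initAux p t)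
    initAux-complete p t           here             r≢[] = ⊥-elim (r≢[] refl)
    initAux-complete p (node x ts) (there lk pos) _    = initChildren-complete p x 0 ts lk pos

    initChildren-complete : ∀ p (x : A) i ts {j t r} → ts ‼ j ≡ just t → Pos t r →
                            0 < occAs (p ++ (i + j) ∷ r) (initChildren p x i ts)
    initChildren-complete p x i (t ∷ ts) {zero} {r = r} refl pos rewrite +-identityʳ i with r
    ... | [] rewrite occ-leaf-≡ (p ++ [ i ]) {x} {label t} = s≤s z≤n
    ... | k ∷ r′ rewrite sym (++-assoc p [ i ] (k ∷ r′)) =
      ≤-trans (initAux-complete (p ++ [ i ]) t pos (λ ()))
              (≤-trans (m≤n+m _ (occ q (leaf (p ++ [ i ]) x (label t)))) (m≤m+n _ _))
      where q = (p ++ [ i ]) ++ k ∷ r′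
    initChildren-complete p x i (t ∷ ts) {suc j} {r = r} lk pos rewrite +-suc i j =
      ≤-trans (initChildren-complete p x (suc i) ts lk pos) (m≤n+m _ _)

  initAux-outside : ∀ p (t : Tree A) {q} → ¬ p ⊏ q → occA q (initAux p t) ≡ 0
  initAux-outside p t ¬p⊏q = ¬>0⇒≡0 λ occ>0 → ¬p⊏q (proj₁ (initAux-below p t occ>0))

  initChildren-right : ∀ p (x : A) i ts {q} → p ++ [ i ] ⊑ q → occAs q (initChildren p x (suc i) ts) ≡ 0
  initChildren-right p x i ts (s , refl) = ¬>0⇒≡0 λ occ>0 → i≢suc-i+j (initChildren-below p x (suc i) ts occ>0)
    where
    i≢suc-i+j : ¬ ∃₂ λ j r → (p ++ [ i ]) ++ s ≡ p ++ (suc i + j) ∷ r × Pos (node x ts) (j ∷ r)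
    i≢suc-i+j (j , r , eq , _) =
      m≢1+m+n i (proj₁ (∷-injective (++-cancelˡ p (i ∷ s) _ (trans (sym (++-assoc p [ i ] s)) eq))))

  mutual
    initAux-unique : ∀ p (t : Tree A) q → occA q (initAux p t) ≤ 1
    initAux-unique p (node x ts) q = initChildren-unique p x 0 ts q

    initChildren-unique : ∀ p (x : A) i ts q → occAs q (initChildren p x i ts) ≤ 1
    initChildren-unique p x i []       q = z≤n
    initChildren-unique p x i (t ∷ ts) q with ≡-dec _≟_ q (p ++ [ i ])
    ... | yes refl
      rewrite initAux-outside (p ++ [ i ]) t (⊏-irrefl {p ++ [ i ]})
            | initChildren-right p x i ts ([] , sym (++-identityʳ _)) = ≤-refl
    ... | no _ with (p ++ [ i ]) ⊏? q
    ...   | yes p∷i⊏q rewrite initChildren-right p x i ts (⊏⇒⊑ p∷i⊏q) =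
      ≤-trans (≤-reflexive (+-identityʳ _)) (initAux-unique (p ++ [ i ]) t q)
    ...   | no ¬p∷i⊏q rewrite initAux-outside (p ++ [ i ]) t ¬p∷i⊏q = initChildren-unique p x (suc i) ts q

  mutual
    initAux-edges : ∀ p (t : Tree A) → suc (edges (initAux p t)) ≡ size t
    initAux-edges p (node x ts) = cong suc (initChildren-edges p x 0 ts)

    initChildren-edges : ∀ p (x : A) i ts → edgesL (initChildren p x i ts) ≡ sizes ts
    initChildren-edges p x i []       = refl
    initChildren-edges p x i (t ∷ ts) = cong₂ _+_ (initAux-edges (p ++ [ i ]) t) (initChildren-edges p x (suc i) ts)

  mutual
    initAux-spanned : ∀ p (t : Tree A) → Spanned 0 p (initAux p t)
    initAux-spanned p (node x ts) = anode (initChildren-spanned p x 0 ts)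

    initChildren-spanned : ∀ p (x : A) i ts → All (SpannedEdge 0 p) (initChildren p x i ts)
    initChildren-spanned p x i []       = []
    initChildren-spanned p x i (t ∷ ts) =
      edge (p ++ [ i ]) (spanning-leaf p i) (initAux-spanned (p ++ [ i ]) t) ∷ initChildren-spanned p x (suc i) ts

-- Step 1

toℕ : Bool → ℕ
toℕ true  = 1
toℕ false = 0

toℕ≤1 : ∀ b → toℕ b ≤ 1
toℕ≤1 true  = ≤-refl
toℕ≤1 false = z≤n

module _ {A : Set} where

  data HMerge : AuxEdge A → AuxEdge A → AuxEdge' A → Set where
    keepsLeft  : ∀ {τ} C₁ u₁ C₂ → HMerge (C₁ , u₁) (C₂ , anode []) (merge τ C₁ C₂ , true , step1 u₁)
    keepsRight : ∀ {τ} C₁ C₂ u₂ → HMerge (C₁ , anode []) (C₂ , u₂) (merge τ C₁ C₂ , true , step1 u₂)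

  data Pairs : List (AuxEdge' A) → List (AuxEdge A) → Set where
    []         : Pairs [] []
    keep∷      : ∀ {C c cs os is} → Pairs os is →
                 Pairs ((C , false , step1 (anode (c ∷ cs))) ∷ os) ((C , anode (c ∷ cs)) ∷ is)
    merge∷     : ∀ {x y o os is} → HMerge x y o → Pairs os is → Pairs (o ∷ os) (x ∷ y ∷ is)
    merge∷keep : ∀ {x y o C u} → HMerge x y o →
                 Pairs (o ∷ (C , false , step1 u) ∷ []) (x ∷ y ∷ (C , u) ∷ [])

  data Pairing : List (AuxEdge' A) → List (AuxEdge A) → Set where
    lone  : ∀ {C u} → Pairing ((C , false , step1 u) ∷ []) ((C , u) ∷ [])
    pairs : ∀ {os is} → Pairs os is → Pairing os is

  hmerge-view : ∀ x y → isLeaf (proj₂ x) ∨ isLeaf (proj₂ y) ≡ true → HMerge x y (hmerge x y)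
  hmerge-view (C₁ , anode [])      (C₂ , anode [])      _ = keepsLeft C₁ (anode []) C₂
  hmerge-view (C₁ , anode [])      (C₂ , anode (_ ∷ _)) _ = keepsRight C₁ C₂ _
  hmerge-view (C₁ , anode (_ ∷ _)) (C₂ , anode [])      _ = keepsLeft C₁ _ C₂
  hmerge-view (C₁ , anode (_ ∷ _)) (C₂ , anode (_ ∷ _)) ()

  pairUp-pairs : ∀ x y rest → Pairs (pairUp (x ∷ y ∷ rest)) (x ∷ y ∷ rest)
  pairUp-pairs x@(_ , anode [])      y                      []       = merge∷ (hmerge-view x y refl) []
  pairUp-pairs x@(_ , anode (_ ∷ _)) y@(_ , anode [])       []       = merge∷ (hmerge-view x y refl) []
  pairUp-pairs (_ , anode (_ ∷ _))   (_ , anode (_ ∷ _))    []       = keep∷ (keep∷ [])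
  pairUp-pairs x@(_ , anode [])      y                      (_ ∷ []) = merge∷keep (hmerge-view x y refl)
  pairUp-pairs x@(_ , anode (_ ∷ _)) y@(_ , anode [])       (_ ∷ []) = merge∷keep (hmerge-view x y refl)
  pairUp-pairs (_ , anode (_ ∷ _))   y@(_ , anode (_ ∷ _)) (z@(_ , anode []) ∷ []) =
    keep∷ (merge∷ (hmerge-view y z refl) [])
  pairUp-pairs (_ , anode (_ ∷ _))   (_ , anode (_ ∷ _))    ((_ , anode (_ ∷ _)) ∷ []) =
    keep∷ (keep∷ (keep∷ []))
  pairUp-pairs x@(_ , anode [])      y                      (w ∷ z ∷ rest) =
    merge∷ (hmerge-view x y refl) (pairUp-pairs w z rest)
  pairUp-pairs x@(_ , anode (_ ∷ _)) y@(_ , anode [])       (w ∷ z ∷ rest) =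
    merge∷ (hmerge-view x y refl) (pairUp-pairs w z rest)
  pairUp-pairs (_ , anode (_ ∷ _))   (_ , anode (_ ∷ _))    (w ∷ z ∷ rest) =
    keep∷ (keep∷ (pairUp-pairs w z rest))

  pairUp-pairing : ∀ cs → Pairing (pairUp cs) cs
  pairUp-pairing []             = pairs []
  pairUp-pairing (_ ∷ [])       = lone
  pairUp-pairing (x ∷ y ∷ rest) = pairs (pairUp-pairs x y rest)

  Pairing-All : ∀ {P : AuxEdge A → Set} {Q : AuxEdge' A → Set} →
                (∀ {C u} → P (C , u) → Q (C , false , step1 u)) →
                (∀ {x y o} → HMerge x y o → P x → P y → Q o) →
                ∀ {os is} → Pairing os is → All P is → All Q os
  Pairing-All {P} {Q} K M lone (p ∷ []) = K p ∷ []
  Pairing-All {P} {Q} K M (pairs ps) = go ps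
    where
    go : ∀ {os is} → Pairs os is → All P is → All Q os
    go []               []               = []
    go (keep∷ ps)       (p ∷ qs)         = K p ∷ go ps qs
    go (merge∷ h ps)    (p ∷ p′ ∷ qs)    = M h p p′ ∷ go ps qs
    go (merge∷keep h)   (p ∷ p′ ∷ p″ ∷ []) = M h p p′ ∷ K p″ ∷ []

  Pairing-sum : ∀ {P : AuxEdge A → Set} (g : AuxEdge' A → ℕ) (h : AuxEdge A → ℕ) →
                (∀ C u → P (C , u) → g (C , false , step1 u) ≡ h (C , u)) →
                (∀ {x y o} → HMerge x y o → P x → P y → g o ≡ h x + h y) →
                ∀ {os is} → Pairing os is → All P is → sum (map g os) ≡ sum (map h is)
  Pairing-sum {P} g h K M lone (p ∷ []) = cong (_+ 0) (K _ _ p)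
  Pairing-sum {P} g h K M (pairs ps) = go ps
    where
    go : ∀ {os is} → Pairs os is → All P is → sum (map g os) ≡ sum (map h is)
    go []             []                 = refl
    go (keep∷ ps)     (p ∷ qs)           = cong₂ _+_ (K _ _ p) (go ps qs)
    go (merge∷ {x} {y} m ps) (p ∷ p′ ∷ qs) = trans (cong₂ _+_ (M m p p′) (go ps qs)) (+-assoc (h x) (h y) _)
    go (merge∷keep {x} {y} m) (p ∷ p′ ∷ p″ ∷ []) =
      trans (cong₂ _+_ (M m p p′) (cong (_+ 0) (K _ _ p″))) (+-assoc (h x) (h y) _)

  Pairing-nonempty : ∀ {os x is} → Pairing os (x ∷ is) → isLeaf' (anode' os) ≡ false
  Pairing-nonempty lone                    = refl
  Pairing-nonempty (pairs (keep∷ _))       = refl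
  Pairing-nonempty (pairs (merge∷ _ _))    = refl
  Pairing-nonempty (pairs (merge∷keep _))  = refl

  isLeaf'-step1 : ∀ u → isLeaf' (step1 u) ≡ isLeaf u
  isLeaf'-step1 (anode [])       = refl
  isLeaf'-step1 (anode (x ∷ xs)) = Pairing-nonempty (pairUp-pairing (x ∷ xs))

  mutual
    edges' : Aux' A → ℕ
    edges' (anode' es) = edgesL' es

    edgesL' : List (AuxEdge' A) → ℕ
    edgesL' []                 = 0
    edgesL' ((_ , _ , u) ∷ es) = suc (edges' u + edgesL' es)

  mutual
    flags : Aux' A → ℕ
    flags (anode' es) = flagsL es

    flagsL : List (AuxEdge' A) → ℕ
    flagsL []                 = 0
    flagsL ((_ , f , u) ∷ es) = toℕ f + flags u + flagsL es

  weight : AuxEdge' A → ℕ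
  weight (_ , f , u) = suc (toℕ f + (edges' u + flags u))

  edgesL'+flagsL : ∀ es → edgesL' es + flagsL es ≡ sum (map weight es)
  edgesL'+flagsL []                 = refl
  edgesL'+flagsL ((_ , f , u) ∷ es) rewrite sym (edgesL'+flagsL es) =
    shuffle (edges' u) (edgesL' es) (toℕ f) (flags u) (flagsL es)
    where
    shuffle : ∀ e E f g G → suc (e + E) + (f + g + G) ≡ suc (f + (e + g)) + (E + G)
    shuffle = solve-∀

  weight₀ : AuxEdge A → ℕ
  weight₀ (_ , u) = suc (edges u)

  edgesL-sum : ∀ cs → edgesL cs ≡ sum (map weight₀ cs)
  edgesL-sum []             = refl
  edgesL-sum ((_ , u) ∷ cs) = cong (suc (edges u) +_) (edgesL-sum cs)

  step1-edges : ∀ t → edges' (step1 t) + flags (step1 t) ≡ edges t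
  step1-edges = Aux-ind _ λ {cs} ih → begin
    edgesL' (pairUp cs) + flagsL (pairUp cs) ≡⟨ edgesL'+flagsL (pairUp cs) ⟩
    sum (map weight (pairUp cs))             ≡⟨ Pairing-sum weight weight₀ (λ _ _ → cong suc) merged (pairUp-pairing cs) ih ⟩
    sum (map weight₀ cs)                     ≡⟨ edgesL-sum cs ⟨
    edgesL cs                                ∎
    where
    open ≡-Reasoning
    merged : ∀ {x y o} → HMerge x y o →
             edges' (step1 (proj₂ x)) + flags (step1 (proj₂ x)) ≡ edges (proj₂ x) →
             edges' (step1 (proj₂ y)) + flags (step1 (proj₂ y)) ≡ edges (proj₂ y) →
             weight o ≡ weight₀ x + weight₀ y
    merged (keepsLeft  C₁ u₁ C₂) h₁ _ = cong suc (trans (cong suc h₁) (sym (+-comm (edges u₁) 1)))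
    merged (keepsRight C₁ C₂ u₂) _ h₂ = cong (λ n → suc (suc n)) h₂

  topFlags : List (AuxEdge' A) → ℕ
  topFlags []                 = 0
  topFlags ((_ , f , _) ∷ es) = toℕ f + topFlags es

  childFlags : List (AuxEdge' A) → ℕ
  childFlags []                 = 0
  childFlags ((_ , _ , u) ∷ es) = flags u + childFlags es

  flagsL-split : ∀ es → flagsL es ≡ topFlags es + childFlags es
  flagsL-split []                 = refl
  flagsL-split ((_ , f , u) ∷ es) rewrite flagsL-split es = shuffle (toℕ f) (flags u) (topFlags es) (childFlags es)
    where
    shuffle : ∀ f g F G → f + g + (F + G) ≡ f + F + (g + G)
    shuffle = solve-∀

  leafChildren : List (AuxEdge' A) → ℕ
  leafChildren []                 = 0
  leafChildren ((_ , _ , u) ∷ es) = toℕ (isLeaf' u) + leafChildren es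

  mutual
    branchLeaves : Aux' A → ℕ
    branchLeaves (anode' es) = (if atLeastTwo es then leafChildren es else 0) + branchLeavesL es

    branchLeavesL : List (AuxEdge' A) → ℕ
    branchLeavesL []                 = 0
    branchLeavesL ((_ , _ , u) ∷ es) = branchLeaves u + branchLeavesL es

  Pairs-leafChildren : ∀ {os is} → Pairs os is → leafChildren os ≤ 2 * topFlags os
  Pairs-leafChildren []                        = z≤n
  Pairs-leafChildren (keep∷ {c = c} {cs} ps) rewrite isLeaf'-step1 (anode (c ∷ cs)) = Pairs-leafChildren ps
  Pairs-leafChildren (merge∷ {os = os} m ps)   = merged {os = os} m (Pairs-leafChildren ps)
    where
    one-more : ∀ b {L F} → L ≤ 2 * F → toℕ b + L ≤ 2 * (1 + F)
    one-more b {L} {F} L≤2F = begin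
      toℕ b + L     ≤⟨ +-mono-≤ (toℕ≤1 b) L≤2F ⟩
      1 + 2 * F     ≤⟨ n≤1+n _ ⟩
      2 + 2 * F     ≡⟨ *-distribˡ-+ 2 1 F ⟨
      2 * (1 + F)   ∎
      where open ≤-Reasoning
    merged : ∀ {x y o os} → HMerge x y o → leafChildren os ≤ 2 * topFlags os →
             leafChildren (o ∷ os) ≤ 2 * topFlags (o ∷ os)
    merged (keepsLeft  _ u₁ _) = one-more (isLeaf' (step1 u₁))
    merged (keepsRight _ _ u₂) = one-more (isLeaf' (step1 u₂))
  Pairs-leafChildren (merge∷keep {C = C} {u} m) = merged m
    where
    merged : ∀ {x y o} → HMerge x y o →
             leafChildren (o ∷ (C , false , step1 u) ∷ []) ≤ 2 * topFlags (o ∷ (C , false , step1 u) ∷ [])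
    merged (keepsLeft  _ u₁ _) = +-mono-≤ (toℕ≤1 (isLeaf' (step1 u₁))) (+-mono-≤ (toℕ≤1 _) z≤n)
    merged (keepsRight _ _ u₂) = +-mono-≤ (toℕ≤1 (isLeaf' (step1 u₂))) (+-mono-≤ (toℕ≤1 _) z≤n)

  Pairing-topLeaves : ∀ {os is} → Pairing os is → (if atLeastTwo os then leafChildren os else 0) ≤ 2 * topFlags os
  Pairing-topLeaves lone                    = z≤n
  Pairing-topLeaves (pairs {os = os} ps) = ≤-trans (if-0≤ (atLeastTwo os)) (Pairs-leafChildren ps)
    where
    if-0≤ : ∀ b {n} → (if b then n else 0) ≤ n
    if-0≤ true  = ≤-refl
    if-0≤ false = z≤n

  BranchLeavesBounded : Aux' A → Set
  BranchLeavesBounded u = branchLeaves u ≤ 2 * flags u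

  branchLeavesL-bounded : ∀ {es} → All (λ e → BranchLeavesBounded (proj₂ (proj₂ e))) es →
                          branchLeavesL es ≤ 2 * childFlags es
  branchLeavesL-bounded {[]}                 []       = z≤n
  branchLeavesL-bounded {(_ , _ , u) ∷ es} (h ∷ hs) =
    ≤-trans (+-mono-≤ h (branchLeavesL-bounded hs)) (≤-reflexive (sym (*-distribˡ-+ 2 (flags u) (childFlags es))))

  step1-branchLeaves : ∀ t → BranchLeavesBounded (step1 t)
  step1-branchLeaves = Aux-ind _ λ {cs} ih → begin
    branchLeaves (anode' (pairUp cs))
      ≤⟨ +-mono-≤ (Pairing-topLeaves (pairUp-pairing cs))
                   (branchLeavesL-bounded (Pairing-All {P = λ e → BranchLeavesBounded (step1 (proj₂ e))}
                                                       {Q = λ e → BranchLeavesBounded (proj₂ (proj₂ e))}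
                                                       (λ h → h) merged (pairUp-pairing cs) ih)) ⟩
    2 * topFlags (pairUp cs) + 2 * childFlags (pairUp cs)
      ≡⟨ *-distribˡ-+ 2 (topFlags (pairUp cs)) (childFlags (pairUp cs)) ⟨
    2 * (topFlags (pairUp cs) + childFlags (pairUp cs))
      ≡⟨ cong (2 *_) (flagsL-split (pairUp cs)) ⟨
    2 * flags (anode' (pairUp cs))
      ∎
    where
    open ≤-Reasoning
    merged : ∀ {x y o} → HMerge x y o → BranchLeavesBounded (step1 (proj₂ x)) →
             BranchLeavesBounded (step1 (proj₂ y)) → BranchLeavesBounded (proj₂ (proj₂ o))
    merged (keepsLeft  _ _ _) h₁ _  = h₁
    merged (keepsRight _ _ _) _  h₂ = h₂

  occE : Path → AuxEdge A → ℕ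
  occE q (C , u) = occ q C + occA q u

  occE' : Path → AuxEdge' A → ℕ
  occE' q (C , _ , u) = occ q C + occA' q u

  occAs-sum : ∀ q cs → occAs q cs ≡ sum (map (occE q) cs)
  occAs-sum q []            = refl
  occAs-sum q ((C , u) ∷ cs) = cong (occE q (C , u) +_) (occAs-sum q cs)

  occAs'-sum : ∀ q es → occAs' q es ≡ sum (map (occE' q) es)
  occAs'-sum q []                = refl
  occAs'-sum q ((C , f , u) ∷ es) = cong (occE' q (C , f , u) +_) (occAs'-sum q es)

  step1-occ : ∀ q t → occA' q (step1 t) ≡ occA q t
  step1-occ q = Aux-ind _ λ {cs} ih → begin
    occAs' q (pairUp cs)           ≡⟨ occAs'-sum q (pairUp cs) ⟩
    sum (map (occE' q) (pairUp cs)) ≡⟨ Pairing-sum (occE' q) (occE q) kept merged (pairUp-pairing cs) ih ⟩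
    sum (map (occE q) cs)           ≡⟨ occAs-sum q cs ⟨
    occAs q cs                      ∎
    where
    open ≡-Reasoning
    kept : ∀ C u → occA' q (step1 u) ≡ occA q u → occE' q (C , false , step1 u) ≡ occE q (C , u)
    kept C _ = cong (occ q C +_)
    merged : ∀ {x y o} → HMerge x y o → occA' q (step1 (proj₂ x)) ≡ occA q (proj₂ x) →
             occA' q (step1 (proj₂ y)) ≡ occA q (proj₂ y) → occE' q o ≡ occE q x + occE q y
    merged (keepsLeft C₁ u₁ C₂) h₁ _ rewrite h₁ = shuffle (occ q C₁) (occ q C₂) (occA q u₁)
      where
      shuffle : ∀ m n k → m + n + k ≡ m + k + (n + 0)
      shuffle = solve-∀
    merged (keepsRight C₁ C₂ u₂) _ h₂ rewrite h₂ = shuffle (occ q C₁) (occ q C₂) (occA q u₂)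
      where
      shuffle : ∀ m n k → m + n + k ≡ m + 0 + (n + k)
      shuffle = solve-∀

  SpannedAfterStep1 : ℕ → Path → AuxEdge A → Set
  SpannedAfterStep1 H v (C , u) = ∃ λ w → Spanning H v w C × Spanned' (suc H) w (step1 u)

  mutual
    step1-spanned : ∀ {H v t} → Spanned H v t → Spanned' (suc H) v (step1 t)
    step1-spanned {H} {v} (anode {cs = cs} ss) =
      anode' (Pairing-All kept merged (pairUp-pairing cs) (step1-spanned-edges ss))
      where
      kept : ∀ {C u} → SpannedAfterStep1 H v (C , u) → SpannedEdge' (suc H) v (C , false , step1 u)
      kept (w , S , I) = edge w (spanning-weaken S) I
      merged : ∀ {x y o} → HMerge x y o → SpannedAfterStep1 H v x → SpannedAfterStep1 H v y →
               SpannedEdge' (suc H) v o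
      merged (keepsLeft  _ _ _) (w₁ , S₁ , I₁) (_  , S₂ , _ ) = edge w₁ (proj₁ (spanning-horizontal _ S₁ S₂)) I₁
      merged (keepsRight _ _ _) (_  , S₁ , _ ) (w₂ , S₂ , I₂) = edge w₂ (proj₂ (spanning-horizontal _ S₁ S₂)) I₂

    step1-spanned-edges : ∀ {H v cs} → All (SpannedEdge H v) cs → All (SpannedAfterStep1 H v) cs
    step1-spanned-edges []                 = []
    step1-spanned-edges (edge w S I ∷ ss) = (w , S , step1-spanned I) ∷ step1-spanned-edges ss

-- Step 2

parity : ℕ → ℕ
parity n = if isEven n then 0 else 1

isEven-suc : ∀ n → isEven (suc n) ≡ not (isEven n)
isEven-suc zero          = refl
isEven-suc (suc zero)    = refl
isEven-suc (suc (suc n)) = isEven-suc n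

parity-suc-even : ∀ n → isEven n ≡ true → parity (suc n) ≡ 1
parity-suc-even n ev rewrite isEven-suc n | ev = refl

parity-suc-odd : ∀ n → isEven n ≡ false → parity (suc n) ≡ 0
parity-suc-odd n ev rewrite isEven-suc n | ev = refl

parity-even : ∀ n → isEven n ≡ true → parity n ≡ 0
parity-even n ev rewrite ev = refl

parity-odd : ∀ n → isEven n ≡ false → parity n ≡ 1
parity-odd n ev rewrite ev = refl

isEven-pred : ∀ n → isEven (suc n) ≡ true → isEven n ≡ false
isEven-pred (suc zero)    _  = refl
isEven-pred (suc (suc n)) ev = isEven-pred n ev

module _ {A : Set} where

  odd-down-nonleaf : ∀ (w : Aux' A) → isEven (down w) ≡ false → isLeaf' w ≡ false
  odd-down-nonleaf (anode' (_ ∷ _)) _ = refl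

  budget : Bool → Aux' A → ℕ
  budget f u = 3 * suc (edges' u) + 4 * branchLeaves u + 4 * flags u + 4 * toℕ f + 2 * toℕ (isLeaf' u)

  -- The potential argument: the surplus 1 + parity on the left of each edge pays, at a node with
  -- at least two children, for the chains of length one above it, which Step 2 cannot shorten.
  mutual
    step2E-bound : ∀ top C f (u : Aux' A) →
      4 * suc (edges (proj₂ (step2E top C f u))) + 1 + parity (down u) ≤ budget f u
    step2E-bound top C false (anode' []) = ≤-refl
    step2E-bound top C true  (anode' []) = m≤m+n 5 4
    step2E-bound top C f (anode' es@(_ ∷ _ ∷ _)) = begin
      4 * suc S + 1 + 0                  ≡⟨ lhs S ⟩
      4 * S + 2 + 3                      ≤⟨ +-monoˡ-≤ 3 (+-monoʳ-≤ (4 * S) (s≤s (s≤s z≤n))) ⟩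
      4 * S + length es + 3              ≤⟨ +-monoˡ-≤ 3 (step2L-bound es) ⟩
      3 * E + 4 * B + 4 * F + 2 * N + 3  ≤⟨ m≤m+n _ (2 * N + 4 * toℕ f) ⟩
      3 * E + 4 * B + 4 * F + 2 * N + 3 + (2 * N + 4 * toℕ f) ≡⟨ rhs E B F N (toℕ f) ⟩
      budget f (anode' es)               ∎
      where
      open ≤-Reasoning
      S = edgesL (step2L true es)
      E = edgesL' es
      B = branchLeavesL es
      F = flagsL es
      N = leafChildren es
      lhs : ∀ S → 4 * suc S + 1 + 0 ≡ 4 * S + 2 + 3
      lhs = solve-∀
      rhs : ∀ E B F N f → 3 * E + 4 * B + 4 * F + 2 * N + 3 + (2 * N + 4 * f)
                          ≡ 3 * suc E + 4 * (N + B) + 4 * F + 4 * f + 2 * 0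
      rhs = solve-∀
    step2E-bound top C f (anode' ((C' , f' , w) ∷ [])) with isEven (down w) in ev
    step2E-bound false C f     (anode' ((C' , f' , w) ∷ [])) | true  = chain-merged-bound f C' f' w ev
    step2E-bound true  C false (anode' ((C' , f' , w) ∷ [])) | true  = chain-merged-bound false C' f' w ev
    step2E-bound true  C true  (anode' ((C' , f' , w) ∷ [])) | true  = chain-blocked-bound C' f' w ev
    step2E-bound top   C f     (anode' ((C' , f' , w) ∷ [])) | false = chain-odd-bound f C' f' w ev

    chain-merged-bound : ∀ f C' f' (w : Aux' A) → isEven (down w) ≡ true →
      4 * suc (edges (step2 false w)) + 1 + parity (suc (down w)) ≤ budget f (anode' ((C' , f' , w) ∷ []))
    chain-merged-bound f C' f' w ev = begin
      4 * suc X + 1 + parity (suc (down w)) ≡⟨ cong (4 * suc X + 1 +_) (parity-suc-even (down w) ev) ⟩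
      4 * suc X + 1 + 1                      ≡⟨ lhs X ⟩
      4 * X + 6                              ≤⟨ +-monoˡ-≤ 6 (step2-subtree-bound w ev) ⟩
      3 * E + 4 * B + 4 * F + 6              ≤⟨ m≤m+n _ (4 * toℕ f' + 4 * toℕ f) ⟩
      3 * E + 4 * B + 4 * F + 6 + (4 * toℕ f' + 4 * toℕ f) ≡⟨ rhs E B F (toℕ f') (toℕ f) ⟩
      budget f (anode' ((C' , f' , w) ∷ [])) ∎
      where
      open ≤-Reasoning
      X = edges (step2 false w)
      E = edges' w
      B = branchLeaves w
      F = flags w
      lhs : ∀ X → 4 * suc X + 1 + 1 ≡ 4 * X + 6
      lhs = solve-∀
      rhs : ∀ E B F f' f → 3 * E + 4 * B + 4 * F + 6 + (4 * f' + 4 * f)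
                           ≡ 3 * suc (suc (E + 0)) + 4 * (0 + (B + 0)) + 4 * (f' + F + 0) + 4 * f + 2 * 0
      rhs = solve-∀

    chain-blocked-bound : ∀ C' f' (w : Aux' A) → isEven (down w) ≡ true →
      4 * suc (edges (anode (step2E false C' f' w ∷ []))) + 1 + parity (suc (down w))
        ≤ budget true (anode' ((C' , f' , w) ∷ []))
    chain-blocked-bound C' f' w ev = begin
      4 * suc (suc (X + 0)) + 1 + parity (suc (down w))
                                             ≡⟨ cong (4 * suc (suc (X + 0)) + 1 +_) (parity-suc-even (down w) ev) ⟩
      4 * suc (suc (X + 0)) + 1 + 1          ≡⟨ lhs X ⟩
      4 * suc X + 1 + 0 + 5                  ≡⟨ cong (λ p → 4 * suc X + 1 + p + 5) (parity-even (down w) ev) ⟨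
      4 * suc X + 1 + parity (down w) + 5    ≤⟨ +-monoˡ-≤ 5 (step2E-bound false C' f' w) ⟩
      budget f' w + 5                        ≤⟨ +-monoˡ-≤ 5 (+-monoʳ-≤ (3 * suc E + 4 * B + 4 * F + 4 * toℕ f')
                                                                     (*-monoʳ-≤ 2 (toℕ≤1 (isLeaf' w)))) ⟩
      3 * suc E + 4 * B + 4 * F + 4 * toℕ f' + 2 * 1 + 5 ≡⟨ rhs E B F (toℕ f') ⟩
      budget true (anode' ((C' , f' , w) ∷ [])) ∎
      where
      open ≤-Reasoning
      X = edges (proj₂ (step2E false C' f' w))
      E = edges' w
      B = branchLeaves w
      F = flags w
      lhs : ∀ X → 4 * suc (suc (X + 0)) + 1 + 1 ≡ 4 * suc X + 1 + 0 + 5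
      lhs = solve-∀
      rhs : ∀ E B F f' → 3 * suc E + 4 * B + 4 * F + 4 * f' + 2 * 1 + 5
                         ≡ 3 * suc (suc (E + 0)) + 4 * (0 + (B + 0)) + 4 * (f' + F + 0) + 4 * 1 + 2 * 0
      rhs = solve-∀

    chain-odd-bound : ∀ f C' f' (w : Aux' A) → isEven (down w) ≡ false →
      4 * suc (edges (anode (step2E false C' f' w ∷ []))) + 1 + parity (suc (down w))
        ≤ budget f (anode' ((C' , f' , w) ∷ []))
    chain-odd-bound f C' f' w ev = begin
      4 * suc (suc (X + 0)) + 1 + parity (suc (down w))
                                             ≡⟨ cong (4 * suc (suc (X + 0)) + 1 +_) (parity-suc-odd (down w) ev) ⟩
      4 * suc (suc (X + 0)) + 1 + 0          ≡⟨ lhs X ⟩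
      4 * suc X + 1 + 1 + 3                  ≡⟨ cong (λ p → 4 * suc X + 1 + p + 3) (parity-odd (down w) ev) ⟨
      4 * suc X + 1 + parity (down w) + 3    ≤⟨ +-monoˡ-≤ 3 (step2E-bound false C' f' w) ⟩
      budget f' w + 3                        ≡⟨ cong (λ l → 3 * suc E + 4 * B + 4 * F + 4 * toℕ f' + 2 * toℕ l + 3)
                                                     (odd-down-nonleaf w ev) ⟩
      3 * suc E + 4 * B + 4 * F + 4 * toℕ f' + 2 * 0 + 3 ≤⟨ m≤m+n _ (4 * toℕ f) ⟩
      3 * suc E + 4 * B + 4 * F + 4 * toℕ f' + 2 * 0 + 3 + 4 * toℕ f ≡⟨ rhs E B F (toℕ f') (toℕ f) ⟩
      budget f (anode' ((C' , f' , w) ∷ [])) ∎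
      where
      open ≤-Reasoning
      X = edges (proj₂ (step2E false C' f' w))
      E = edges' w
      B = branchLeaves w
      F = flags w
      lhs : ∀ X → 4 * suc (suc (X + 0)) + 1 + 0 ≡ 4 * suc X + 1 + 1 + 3
      lhs = solve-∀
      rhs : ∀ E B F f' f → 3 * suc E + 4 * B + 4 * F + 4 * f' + 2 * 0 + 3 + 4 * f
                           ≡ 3 * suc (suc (E + 0)) + 4 * (0 + (B + 0)) + 4 * (f' + F + 0) + 4 * f + 2 * 0
      rhs = solve-∀

    step2-subtree-bound : ∀ (w : Aux' A) → isEven (down w) ≡ true →
      4 * edges (step2 false w) ≤ 3 * edges' w + 4 * branchLeaves w + 4 * flags w
    step2-subtree-bound (anode' []) _ = z≤n
    step2-subtree-bound (anode' es@(_ ∷ _ ∷ _)) _ = begin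
      4 * S                              ≤⟨ m≤m+n _ (length es) ⟩
      4 * S + length es                  ≤⟨ step2L-bound es ⟩
      3 * E + 4 * B + 4 * F + 2 * N      ≤⟨ m≤m+n _ (2 * N) ⟩
      3 * E + 4 * B + 4 * F + 2 * N + 2 * N ≡⟨ rhs E B F N ⟩
      3 * E + 4 * (N + B) + 4 * F        ∎
      where
      open ≤-Reasoning
      S = edgesL (step2L true es)
      E = edgesL' es
      B = branchLeavesL es
      F = flagsL es
      N = leafChildren es
      rhs : ∀ E B F N → 3 * E + 4 * B + 4 * F + 2 * N + 2 * N ≡ 3 * E + 4 * (N + B) + 4 * F
      rhs = solve-∀
    step2-subtree-bound (anode' ((C , f , x) ∷ [])) ev = begin
      4 * suc (X + 0)                        ≤⟨ m≤m+n _ 2 ⟩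
      4 * suc (X + 0) + 2                    ≡⟨ lhs X ⟩
      4 * suc X + 1 + 1                      ≡⟨ cong (4 * suc X + 1 +_) (parity-odd (down x) ev′) ⟨
      4 * suc X + 1 + parity (down x)        ≤⟨ step2E-bound false C f x ⟩
      budget f x                             ≡⟨ cong (λ l → 3 * suc E + 4 * B + 4 * F + 4 * toℕ f + 2 * toℕ l)
                                                     (odd-down-nonleaf x ev′) ⟩
      3 * suc E + 4 * B + 4 * F + 4 * toℕ f + 2 * 0 ≡⟨ rhs E B F (toℕ f) ⟩
      3 * suc (E + 0) + 4 * (0 + (B + 0)) + 4 * (toℕ f + F + 0) ∎
      where
      open ≤-Reasoning
      ev′ = isEven-pred (down x) ev
      X = edges (proj₂ (step2E false C f x))
      E = edges' x
      B = branchLeaves x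
      F = flags x
      lhs : ∀ X → 4 * suc (X + 0) + 2 ≡ 4 * suc X + 1 + 1
      lhs = solve-∀
      rhs : ∀ E B F f → 3 * suc E + 4 * B + 4 * F + 4 * f + 2 * 0 ≡ 3 * suc (E + 0) + 4 * (0 + (B + 0)) + 4 * (f + F + 0)
      rhs = solve-∀

    step2L-bound : ∀ es → 4 * edgesL (step2L true es) + length es
                            ≤ 3 * edgesL' es + 4 * branchLeavesL es + 4 * flagsL es + 2 * leafChildren es
    step2L-bound [] = z≤n
    step2L-bound ((C , f , u) ∷ es) = begin
      4 * suc (X + S) + suc (length es)       ≡⟨ lhs X S (length es) ⟩
      4 * suc X + 1 + (4 * S + length es)     ≤⟨ +-mono-≤ (≤-trans (m≤m+n _ (parity (down u))) (step2E-bound true C f u))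
                                                           (step2L-bound es) ⟩
      budget f u + (3 * E′ + 4 * B′ + 4 * F′ + 2 * N′) ≡⟨ rhs E E′ B B′ (toℕ f) F F′ (toℕ (isLeaf' u)) N′ ⟩
      3 * suc (E + E′) + 4 * (B + B′) + 4 * (toℕ f + F + F′) + 2 * (toℕ (isLeaf' u) + N′) ∎
      where
      open ≤-Reasoning
      X = edges (proj₂ (step2E true C f u))
      S = edgesL (step2L true es)
      E = edges' u
      B = branchLeaves u
      F = flags u
      E′ = edgesL' es
      B′ = branchLeavesL es
      F′ = flagsL es
      N′ = leafChildren es
      lhs : ∀ X S l → 4 * suc (X + S) + suc l ≡ 4 * suc X + 1 + (4 * S + l)
      lhs = solve-∀
      rhs : ∀ E E′ B B′ f F F′ l N′ →
            3 * suc E + 4 * B + 4 * F + 4 * f + 2 * l + (3 * E′ + 4 * B′ + 4 * F′ + 2 * N′)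
              ≡ 3 * suc (E + E′) + 4 * (B + B′) + 4 * (f + F + F′) + 2 * (l + N′)
      rhs = solve-∀

  mutual
    step2E-edges : ∀ top C f (u : Aux' A) → edges (proj₂ (step2E top C f u)) ≤ edges' u
    step2E-edges top C f (anode' [])                    = z≤n
    step2E-edges top C f (anode' es@(_ ∷ _ ∷ _))        = step2L-edges true es
    step2E-edges top C f (anode' ((C' , f' , w) ∷ [])) with isEven (down w) ∧ (not top ∨ not f)
    ... | true  = ≤-trans (step2-edges false w) (≤-trans (n≤1+n _) (s≤s (≤-reflexive (sym (+-identityʳ _)))))
    ... | false = s≤s (+-monoˡ-≤ 0 (step2E-edges false C' f' w))

    step2-edges : ∀ b (w : Aux' A) → edges (step2 b w) ≤ edges' w
    step2-edges b (anode' es) = step2L-edges _ es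

    step2L-edges : ∀ top es → edgesL (step2L top es) ≤ edgesL' es
    step2L-edges top []                 = z≤n
    step2L-edges top ((C , f , u) ∷ es) = s≤s (+-mono-≤ (step2E-edges top C f u) (step2L-edges top es))

  mutual
    step2E-occ : ∀ q top C f (u : Aux' A) → occE q (step2E top C f u) ≡ occ q C + occA' q u
    step2E-occ q top C f (anode' [])                    = refl
    step2E-occ q top C f (anode' es@(_ ∷ _ ∷ _))        = cong (occ q C +_) (step2L-occ q true es)
    step2E-occ q top C f (anode' ((C' , f' , w) ∷ [])) with isEven (down w) ∧ (not top ∨ not f)
    ... | true  rewrite step2-occ q false w = shuffle (occ q C) (occ q C') (occA' q w)
      where
      shuffle : ∀ m n k → m + n + k ≡ m + (n + k + 0)
      shuffle = solve-∀
    ... | false = cong (λ k → occ q C + (k + 0)) (step2E-occ q false C' f' w)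

    step2-occ : ∀ q b (w : Aux' A) → occA q (step2 b w) ≡ occA' q w
    step2-occ q b (anode' es) = step2L-occ q _ es

    step2L-occ : ∀ q top es → occAs q (step2L top es) ≡ occAs' q es
    step2L-occ q top []                 = refl
    step2L-occ q top ((C , f , u) ∷ es) = cong₂ _+_ (step2E-occ q top C f u) (step2L-occ q top es)

  mutual
    step2E-spanned : ∀ {H v} top C f (u : Aux' A) → SpannedEdge' H v (C , f , u) →
                     SpannedEdge (suc H) v (step2E top C f u)
    step2E-spanned top C f (anode' []) (edge w S _) = edge w (spanning-weaken S) (anode [])
    step2E-spanned top C f (anode' es@(_ ∷ _ ∷ _)) (edge w S (anode' ss)) =
      edge w (spanning-weaken S) (anode (step2L-spanned true es ss))
    step2E-spanned top C f (anode' ((C' , f' , w) ∷ [])) (edge w₁ S₁ (anode' (edge w₂ S₂ I₂ ∷ [])))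
      with isEven (down w) ∧ (not top ∨ not f)
    ... | true  = edge w₂ (spanning-vertical _ S₁ S₂) (step2-spanned false w I₂)
    ... | false = edge w₁ (spanning-weaken S₁) (anode (step2E-spanned false C' f' w (edge w₂ S₂ I₂) ∷ []))

    step2-spanned : ∀ {H v} b (w : Aux' A) → Spanned' H v w → Spanned (suc H) v (step2 b w)
    step2-spanned b (anode' es) (anode' ss) = anode (step2L-spanned _ es ss)

    step2L-spanned : ∀ {H v} top es → All (SpannedEdge' H v) es → All (SpannedEdge (suc H) v) (step2L top es)
    step2L-spanned top []                 []       = []
    step2L-spanned top ((C , f , u) ∷ es) (s ∷ ss) = step2E-spanned top C f u s ∷ step2L-spanned top es ss

  step2-root-bound : ∀ es → 4 * edgesL (step2L true es) ≤ 3 * edgesL' es + 4 * branchLeaves (anode' es) + 4 * flagsL es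
                            ⊎ edgesL' es ≡ 1
  step2-root-bound []                                  = inj₁ z≤n
  step2-root-bound ((C , f , anode' []) ∷ [])          = inj₂ refl
  step2-root-bound es@((C , f , anode' (_ ∷ _)) ∷ []) = inj₁ (begin
    4 * S                                  ≤⟨ m≤m+n _ 1 ⟩
    4 * S + 1                              ≤⟨ step2L-bound es ⟩
    3 * E + 4 * B + 4 * F + 2 * (0 + 0)    ≡⟨ rhs E B F ⟩
    3 * E + 4 * (0 + B) + 4 * F            ∎)
    where
    open ≤-Reasoning
    S = edgesL (step2L true es)
    E = edgesL' es
    B = branchLeavesL es
    F = flagsL es
    rhs : ∀ E B F → 3 * E + 4 * B + 4 * F + 2 * (0 + 0) ≡ 3 * E + 4 * (0 + B) + 4 * F
    rhs = solve-∀
  step2-root-bound es@(_ ∷ _ ∷ _) = inj₁ (begin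
    4 * S                                  ≤⟨ m≤m+n _ (length es) ⟩
    4 * S + length es                      ≤⟨ step2L-bound es ⟩
    3 * E + 4 * B + 4 * F + 2 * N          ≤⟨ m≤m+n _ (2 * N) ⟩
    3 * E + 4 * B + 4 * F + 2 * N + 2 * N  ≡⟨ rhs E B F N ⟩
    3 * E + 4 * (N + B) + 4 * F            ∎)
    where
    open ≤-Reasoning
    S = edgesL (step2L true es)
    E = edgesL' es
    B = branchLeavesL es
    F = flagsL es
    N = leafChildren es
    rhs : ∀ E B F N → 3 * E + 4 * B + 4 * F + 2 * N + 2 * N ≡ 3 * E + 4 * (N + B) + 4 * F
    rhs = solve-∀

  iteration-shrinks : ∀ (t : Aux A) → 2 ≤ edges t → 13 * edges (iteration t) ≤ 12 * edges t
  iteration-shrinks t@(anode cs) 2≤t with step2-root-bound (pairUp cs)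
  ... | inj₁ bound = begin
    13 * t₂                  ≡⟨ solve-13 t₂ ⟩
    4 * t₂ + 9 * t₂          ≤⟨ +-mono-≤ bound (*-monoʳ-≤ 9 (step2-edges true (step1 t))) ⟩
    3 * t₁ + 4 * B + 4 * F + 9 * t₁
      ≤⟨ +-monoˡ-≤ (9 * t₁) (+-monoˡ-≤ (4 * F) (+-monoʳ-≤ (3 * t₁) (*-monoʳ-≤ 4 (step1-branchLeaves t)))) ⟩
    3 * t₁ + 4 * (2 * F) + 4 * F + 9 * t₁ ≡⟨ solve-12 t₁ F ⟩
    12 * (t₁ + F)            ≡⟨ cong (12 *_) (step1-edges t) ⟩
    12 * edges t             ∎
    where
    open ≤-Reasoning
    t₂ = edges (iteration t)
    t₁ = edgesL' (pairUp cs)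
    F  = flagsL (pairUp cs)
    B  = branchLeaves (anode' (pairUp cs))
    solve-13 : ∀ x → 13 * x ≡ 4 * x + 9 * x
    solve-13 = solve-∀
    solve-12 : ∀ x F → 3 * x + 4 * (2 * F) + 4 * F + 9 * x ≡ 12 * (x + F)
    solve-12 = solve-∀
  ... | inj₂ single = begin
    13 * edges (iteration t)  ≤⟨ *-monoʳ-≤ 13 (≤-trans (step2-edges true (step1 t)) (≤-reflexive single)) ⟩
    13                        ≤⟨ m≤m+n 13 11 ⟩
    12 * 2                    ≤⟨ *-monoʳ-≤ 12 2≤t ⟩
    12 * edges t              ∎
    where open ≤-Reasoning

-- The greedy construction

module _ {A : Set} where

  rounds : ∀ {t : Aux A} {𝒯} → Greedy t 𝒯 → ℕ
  rounds (done _)     = 0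
  rounds (loop _ _ g) = suc (rounds g)

  ≢0,1⇒≥2 : ∀ {n} → (n ≡ 0 → ⊥) → (n ≡ 1 → ⊥) → 2 ≤ n
  ≢0,1⇒≥2 {zero}        n≢0 _   = ⊥-elim (n≢0 refl)
  ≢0,1⇒≥2 {suc zero}    _   n≢1 = ⊥-elim (n≢1 refl)
  ≢0,1⇒≥2 {suc (suc n)} _   _   = s≤s (s≤s z≤n)

  rounds-bound : ∀ {t 𝒯} (g : Greedy t 𝒯) → 13 ^ rounds g ≤ 12 ^ rounds g * edges t
  rounds-bound (done _) = s≤s z≤n
  rounds-bound {t} (loop t≢0 t≢1 g) = begin
    13 * 13 ^ k                            ≤⟨ *-monoʳ-≤ 13 (rounds-bound g) ⟩
    13 * (12 ^ k * edges (iteration t))    ≡⟨ shuffle (12 ^ k) (edges (iteration t)) ⟩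
    12 ^ k * (13 * edges (iteration t))    ≤⟨ *-monoʳ-≤ (12 ^ k) (iteration-shrinks t (≢0,1⇒≥2 t≢0 t≢1)) ⟩
    12 ^ k * (12 * edges t)                ≡⟨ shuffle′ (12 ^ k) (edges t) ⟩
    12 * 12 ^ k * edges t                  ∎
    where
    open ≤-Reasoning
    k = rounds g
    shuffle : ∀ x y → 13 * (x * y) ≡ x * (13 * y)
    shuffle = solve-∀
    shuffle′ : ∀ x y → x * (12 * y) ≡ 12 * x * y
    shuffle′ = solve-∀

  iteration-spanned : ∀ {H v} {t : Aux A} → Spanned H v t → Spanned (suc (suc H)) v (iteration t)
  iteration-spanned {t = t} I = step2-spanned true (step1 t) (step1-spanned I)

  greedy-spanned : ∀ {t 𝒯 H v} (g : Greedy t 𝒯) → Spanned H v t → Clustered 𝒯 × height 𝒯 ≤ 2 * rounds g + H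
  greedy-spanned (done _) (anode (edge _ (spanning _ _ k h) _ ∷ [])) = k , h
  greedy-spanned {H = H} (loop _ _ g) I with greedy-spanned g (iteration-spanned I)
  ... | k , h = k , ≤-trans h (≤-reflexive (shuffle (rounds g) H))
    where
    shuffle : ∀ k H → 2 * k + suc (suc H) ≡ 2 * suc k + H
    shuffle = solve-∀

  iteration-occ : ∀ q (t : Aux A) → occA q (iteration t) ≡ occA q t
  iteration-occ q t = trans (step2-occ q true (step1 t)) (step1-occ q t)

  greedy-occ : ∀ {t 𝒯} → Greedy t 𝒯 → ∀ q → occ q 𝒯 ≡ occA q t
  greedy-occ (done {u = anode []} _) q = sym (trans (+-identityʳ _) (+-identityʳ _))
  greedy-occ {t} (loop _ _ g) q = trans (greedy-occ g q) (iteration-occ q t)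

2^m*12^[9m]≤13^[9m] : ∀ m → 2 ^ m * 12 ^ (m * 9) ≤ 13 ^ (m * 9)
2^m*12^[9m]≤13^[9m] zero    = ≤-refl
2^m*12^[9m]≤13^[9m] (suc m) = begin
  2 * 2 ^ m * 12 ^ (9 + m * 9)              ≡⟨ cong (2 * 2 ^ m *_) (^-distribˡ-+-* 12 9 (m * 9)) ⟩
  2 * 2 ^ m * (12 ^ 9 * 12 ^ (m * 9))       ≡⟨ shuffle (2 ^ m) (12 ^ 9) (12 ^ (m * 9)) ⟩
  2 * 12 ^ 9 * (2 ^ m * 12 ^ (m * 9))       ≤⟨ *-mono-≤ (≤ᵇ⇒≤ (2 * 12 ^ 9) (13 ^ 9) _) (2^m*12^[9m]≤13^[9m] m) ⟩
  13 ^ 9 * 13 ^ (m * 9)                     ≡⟨ ^-distribˡ-+-* 13 9 (m * 9) ⟨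
  13 ^ (9 + m * 9)                          ∎
  where
  open ≤-Reasoning
  shuffle : ∀ a b c → 2 * a * (b * c) ≡ 2 * b * (a * c)
  shuffle = solve-∀

2^m*12^[d+9m]≤13^[d+9m] : ∀ m d → 2 ^ m * 12 ^ (d + m * 9) ≤ 13 ^ (d + m * 9)
2^m*12^[d+9m]≤13^[d+9m] m d = begin
  2 ^ m * 12 ^ (d + m * 9)             ≡⟨ cong (2 ^ m *_) (^-distribˡ-+-* 12 d (m * 9)) ⟩
  2 ^ m * (12 ^ d * 12 ^ (m * 9))      ≡⟨ shuffle (2 ^ m) (12 ^ d) (12 ^ (m * 9)) ⟩
  12 ^ d * (2 ^ m * 12 ^ (m * 9))      ≤⟨ *-mono-≤ (^-monoˡ-≤ d (n≤1+n 12)) (2^m*12^[9m]≤13^[9m] m) ⟩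
  13 ^ d * 13 ^ (m * 9)                ≡⟨ ^-distribˡ-+-* 13 d (m * 9) ⟨
  13 ^ (d + m * 9)                     ∎
  where
  open ≤-Reasoning
  shuffle : ∀ a b c → a * (b * c) ≡ b * (a * c)
  shuffle = solve-∀

rounds-log : ∀ k n → 13 ^ k ≤ 12 ^ k * n → k ≤ 9 * ⌊log₂ n ⌋ + 8
rounds-log k n h = begin
  k                  ≡⟨ m≡m%n+[m/n]*n k 9 ⟩
  k % 9 + m * 9      ≤⟨ +-mono-≤ (s≤s⁻¹ (m%n<n k 9)) (*-monoˡ-≤ 9 m≤log) ⟩
  8 + ⌊log₂ n ⌋ * 9  ≡⟨ +-comm 8 _ ⟩
  ⌊log₂ n ⌋ * 9 + 8  ≡⟨ cong (_+ 8) (*-comm ⌊log₂ n ⌋ 9) ⟩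
  9 * ⌊log₂ n ⌋ + 8  ∎
  where
  open ≤-Reasoning
  m = k / 9
  d = k % 9
  2^m*12^k≤13^k : 2 ^ m * 12 ^ k ≤ 13 ^ k
  2^m*12^k≤13^k = subst (λ j → 2 ^ m * 12 ^ j ≤ 13 ^ j) (sym (m≡m%n+[m/n]*n k 9)) (2^m*12^[d+9m]≤13^[d+9m] m d)
  2^m≤n : 2 ^ m ≤ n
  2^m≤n = *-cancelʳ-≤ (2 ^ m) n (12 ^ k) {{m^n≢0 12 k}}
            (≤-trans 2^m*12^k≤13^k (≤-trans h (≤-reflexive (*-comm (12 ^ k) n))))
  m≤log : m ≤ ⌊log₂ n ⌋
  m≤log = subst (_≤ ⌊log₂ n ⌋) (⌊log₂[2^n]⌋≡n m) (⌊log₂⌋-mono-≤ 2^m≤n)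

-- The decomposition of T(z)

module _ {A : Set} where

  ‼-size : ∀ (ts : List (Tree A)) j {t} → ts ‼ j ≡ just t → size t ≤ sizes ts
  ‼-size (t ∷ ts) zero    refl = m≤m+n (size t) (sizes ts)
  ‼-size (t ∷ ts) (suc j) lk   = ≤-trans (‼-size ts j lk) (m≤n+m (sizes ts) (size t))

  nonroot-size : ∀ (T : Tree A) {j r} → Pos T (j ∷ r) → 2 ≤ size T
  nonroot-size (node _ ts) (there {t = node _ _} lk _) = s≤s (≤-trans (s≤s z≤n) (‼-size ts _ lk))

  internal-size : ∀ (T : Tree A) z → Internal T z → 2 ≤ size T
  internal-size T []      (_ , pos) = nonroot-size T pos
  internal-size T (_ ∷ _) (_ , pos) = nonroot-size T pos

  node-witness : ∀ {Cs : List (TopTree A)} {q} → Any (λ C → NodeOf C q) Cs →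
                 ∃ λ q′ → Any (λ C → EdgeOf C q′) Cs × (q ≡ q′ ⊎ ∃ λ j → q′ ≡ q ++ [ j ])
  node-witness (here (q′ , e , end)) = q′ , here e , end
  node-witness (there n∈) with node-witness n∈
  ... | q′ , e∈ , end = q′ , there e∈ , end

  module GreedyTopTreeFacts (T : Tree A) (𝒯 : TopTree A) (g : GreedyTopTree T 𝒯) where

    occ-initial : ∀ q → occ q 𝒯 ≡ occA q (initAux [] T)
    occ-initial = greedy-occ g

    occ≤1 : ∀ q → occ q 𝒯 ≤ 1
    occ≤1 q = ≤-trans (≤-reflexive (occ-initial q)) (initAux-unique [] T q)

    edge⇒Pos : ∀ {q} → EdgeOf 𝒯 q → Pos T q
    edge⇒Pos {q} e with initAux-below [] T (subst (0 <_) (occ-initial q) (EdgeOf⇒occ>0 e))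
    ... | _ , _ , refl , pos = pos

    Pos⇒edge : ∀ {q} → Pos T q → q ≢ [] → EdgeOf 𝒯 q
    Pos⇒edge {q} pos q≢[] = occ>0⇒EdgeOf 𝒯 (subst (0 <_) (sym (occ-initial q)) (initAux-complete [] T pos q≢[]))

    clustered : Clustered 𝒯
    clustered = proj₁ (greedy-spanned g (initAux-spanned [] T))

    height-log : height 𝒯 ≤ 2 * (9 * ⌊log₂ size T ⌋ + 8)
    height-log = begin
      height 𝒯           ≤⟨ proj₂ (greedy-spanned g (initAux-spanned [] T)) ⟩
      2 * rounds g + 0   ≡⟨ +-identityʳ _ ⟩
      2 * rounds g       ≤⟨ *-monoʳ-≤ 2 (rounds-log (rounds g) (size T) rounds≤) ⟩
      2 * (9 * ⌊log₂ size T ⌋ + 8) ∎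
      where
      open ≤-Reasoning
      rounds≤ : 13 ^ rounds g ≤ 12 ^ rounds g * size T
      rounds≤ = ≤-trans (rounds-bound g)
                  (*-monoʳ-≤ (12 ^ rounds g) (≤-trans (n≤1+n _) (≤-reflexive (initAux-edges [] T))))

  module _ (T : Tree A) (𝒯 : TopTree A) (g : GreedyTopTree T 𝒯) (z : Path) where
    open GreedyTopTreeFacts T 𝒯 g

    pieces-edge-sound : ∀ {q} → Any (λ C → EdgeOf C q) (pieces z 𝒯) → EdgeOfSubtree T z q
    pieces-edge-sound e∈ with lookupAny (All.zip (pieces-clusters z 𝒯 , pieces-inside z 𝒯)) e∈
    ... | (cl , inside) , e = edge⇒Pos (ClusterOf-edge cl e) , inside e

    pieces-edge-complete : ∀ {q} → EdgeOfSubtree T z q → Any (λ C → EdgeOf C q) (pieces z 𝒯)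
    pieces-edge-complete (pos , z⊏q@(r , r≢[] , refl)) = pieces-complete z 𝒯 (Pos⇒edge pos (++-nonempty z r≢[])) z⊏q

    pieces-node-sound : ∀ {q} → Any (λ C → NodeOf C q) (pieces z 𝒯) → NodeOfSubtree T z q
    pieces-node-sound n∈ with node-witness n∈
    ... | q′ , e∈ , end with pieces-edge-sound e∈ | end
    ...   | pos , z⊏q′ | inj₁ refl     = pos , ⊏⇒⊑ z⊏q′
    ...   | pos , z⊏q′ | inj₂ (j , refl) = Pos-prefix T _ pos , ⊏-parent j z⊏q′

    pieces-node-complete : Internal T z → ∀ {q} → NodeOfSubtree T z q → Any (λ C → NodeOf C q) (pieces z 𝒯)
    pieces-node-complete (i , pos-child) {q} (pos , z⊑q) with ⊑⇒≡⊎⊏ z⊑q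
    ... | inj₂ z⊏q  = Any.map (λ e → q , e , inj₁ refl) (pieces-edge-complete (pos , z⊏q))
    ... | inj₁ refl =
      Any.map (λ e → q ++ [ i ] , e , inj₂ (i , refl)) (pieces-edge-complete (pos-child , ⊏-snoc q i))

    pieces-length-log : Internal T z → length (pieces z 𝒯) ≤ 35 * ⌊log₂ size T ⌋
    pieces-length-log internal = begin
      length (pieces z 𝒯)          ≤⟨ pieces-length z 𝒯 clustered occ≤1 ⟩
      suc (height 𝒯)               ≤⟨ s≤s height-log ⟩
      suc (2 * (9 * L + 8))        ≡⟨ shuffle L ⟩
      18 * L + 17 * 1              ≤⟨ +-monoʳ-≤ (18 * L) (*-monoʳ-≤ 17 1≤L) ⟩
      18 * L + 17 * L              ≡⟨ *-distribʳ-+ L 18 17 ⟨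
      35 * L                       ∎
      where
      open ≤-Reasoning
      L = ⌊log₂ size T ⌋
      1≤L : 1 ≤ L
      1≤L = ⌊log₂⌋-mono-≤ (internal-size T z internal)
      shuffle : ∀ L → suc (2 * (9 * L + 8)) ≡ 18 * L + 17 * 1
      shuffle = solve-∀

corollary2 : ∃ λ (c : ℕ) →
    ∀ {A : Set} (T : Tree A) (𝒯 : TopTree A) → GreedyTopTree T 𝒯 →
    ∀ (z : Path) → Internal T z →
    ∃ λ (Cs : List (TopTree A)) →
    All (λ C → ClusterOf C 𝒯) Cs
    × length Cs ≤ c * ⌊log₂ size T ⌋
    × (∀ q → Any (λ C → EdgeOf C q) Cs ⇔ EdgeOfSubtree T z q)
    × (∀ q → Any (λ C → NodeOf C q) Cs ⇔ NodeOfSubtree T z q)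
corollary2 = 35 , λ T 𝒯 g z internal →
  pieces z 𝒯 ,
  pieces-clusters z 𝒯 ,
  pieces-length-log T 𝒯 g z internal ,
  (λ q → mk⇔ (pieces-edge-sound T 𝒯 g z) (pieces-edge-complete T 𝒯 g z)) ,
  (λ q → mk⇔ (pieces-node-sound T 𝒯 g z) (pieces-node-complete T 𝒯 g z internal))
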